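{- For integers $n, m \geq 0$, let $cp_{1-2}(n, m)$ denote the number of partitions of $n$ into $m$ parts $\lambda_1 \leq \cdots \leq \lambda_m$ such that $\lambda_{i+1} - \lambda_i \geq 2$ for all $i$, and $\lambda_{i+1} - \lambda_i \geq 4$ unless $\lambda_i + \lambda_{i+1} \equiv 2 \pmod{3}$. Then \[ \sum_{m, n \geq 0} cp_{1-2}(n,m) q^n x^m = \sum_{n_1, n_2 \geq 0} \frac{ q^{6n_2^2 - n_2 + 2n_1^2 - n_1 + 6n_2 n_1} x^{2n_2 + n_1} }{ (q; q)_{n_1} (q^3; q^3)_{n_2} }. \]
   Context: A partition of $n$ into $m$ parts is a non-decreasing sequence of $m$ positive integers summing to $n$. For $n \geq 0$, $(a; q)_n = \prod_{j=1}^{n} (1 - a q^{j-1})$, with the empty product equal to $1$. -}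

module Defs where

open import Data.Nat as ℕ using (ℕ; zero; suc; _∸_; _≤ᵇ_; _≡ᵇ_; _%_)
open import Data.Integer as ℤ using (ℤ; +_; -_)
open import Data.List using (List; []; _∷_; map; concatMap; filter; length; upTo; zipWith; foldr; all)
open import Relation.Nullary.Decidable using (T?)
open import Data.Bool using (Bool; true; false; _∧_; _∨_; if_then_else_)

listsOf : ℕ → List ℕ → List (List ℕ)
listsOf zero    xs = [] ∷ []
listsOf (suc m) xs = concatMap (λ x → map (x ∷_) (listsOf m xs)) xs

oneTo : ℕ → List ℕ
oneTo n = map suc (upTo n)

pairOK : ℕ → ℕ → Bool
pairOK a b = (a ≤ᵇ b) ∧ (2 ≤ᵇ (b ∸ a)) ∧ ((4 ≤ᵇ (b ∸ a)) ∨ (((a ℕ.+ b) % 3) ≡ᵇ 2))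

chainOK : List ℕ → Bool
chainOK []           = true
chainOK (a ∷ [])     = true
chainOK (a ∷ b ∷ l)  = pairOK a b ∧ chainOK (b ∷ l)

sumℕ : List ℕ → ℕ
sumℕ = foldr ℕ._+_ 0

-- a list λ₁,…,λₘ of positive integers (all parts ≤ n, which is automatic for
-- a partition of n) is counted iff it sums to n and satisfies the conditions
-- (the non-decreasing condition is included in pairOK)
isCP : ℕ → List ℕ → Bool
isCP n l = (sumℕ l ≡ᵇ n) ∧ chainOK l

cp : ℕ → ℕ → ℕ
cp n m = length (filter (λ l → T? (isCP n l)) (listsOf m (oneTo n)))

sumℤ : List ℤ → ℤ
sumℤ = foldr ℤ._+_ (+ 0)

Series : Set
Series = ℕ → ℤ

oneS : Series
oneS zero    = + 1
oneS (suc _) = + 0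

qS : Series
qS 1 = + 1
qS _ = + 0

_-S_ : Series → Series → Series
(f -S g) k = f k ℤ.- g k

_*S_ : Series → Series → Series
(f *S g) k = sumℤ (map (λ i → f i ℤ.* g (k ∸ i)) (upTo (suc k)))

_^S_ : Series → ℕ → Series
f ^S zero  = oneS
f ^S suc n = f *S (f ^S n)

poch : Series → Series → ℕ → Series
poch a p zero    = oneS
poch a p (suc n) = poch a p n *S (oneS -S (a *S (p ^S n)))

-- multiplicative inverse of a series f with constant term 1:
-- g₀ = 1,  gₖ = - Σ_{i=1}^{k} fᵢ g_{k-i}.
-- invRev f k = [g_k, g_{k-1}, …, g_0]
invRev : Series → ℕ → List ℤ
invRev f zero    = + 1 ∷ []
invRev f (suc k) = (- sumℤ (zipWith (λ i gi → f (suc i) ℤ.* gi) (upTo (suc k)) prev)) ∷ prev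
  where prev = invRev f k

head0 : List ℤ → ℤ
head0 []      = + 0
head0 (x ∷ _) = x

invS : Series → Series
invS f k = head0 (invRev f k)

-- exponent 6n₂² - n₂ + 2n₁² - n₁ + 6n₂n₁ (each difference is ≥ 0)
expo : ℕ → ℕ → ℕ
expo n₁ n₂ = ((6 ℕ.* n₂ ℕ.* n₂) ∸ n₂) ℕ.+ ((2 ℕ.* n₁ ℕ.* n₁) ∸ n₁) ℕ.+ 6 ℕ.* n₂ ℕ.* n₁

term : ℕ → ℕ → Series
term n₁ n₂ = (qS ^S expo n₁ n₂) *S invS (poch qS qS n₁ *S poch (qS ^S 3) (qS ^S 3) n₂)

-- coefficient of xᵐ qⁿ on the RHS: sum over n₁, n₂ with 2n₂ + n₁ = m
-- (necessarily n₁, n₂ ≤ m)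
rhsCoeff : ℕ → ℕ → ℤ
rhsCoeff n m =
  sumℤ (map (λ n₁ → sumℤ (map (λ n₂ →
        if (2 ℕ.* n₂ ℕ.+ n₁) ≡ᵇ m then term n₁ n₂ n else + 0)
      (upTo (suc m)))) (upTo (suc m)))

open import Relation.Binary.PropositionalEquality using (_≡_; refl)
private
  t1 : cp 10 2 ≡ 3
  t1 = refl
  t2 : rhsCoeff 4 1 ≡ + (cp 4 1)
  t2 = refl
  t3 : rhsCoeff 5 2 ≡ + (cp 5 2)
  t3 = refl

-- Both sides are the first members A₁ of triples of sequences (A₁ m, A₂ m, A₃ m) of series in q that
-- satisfy A₁ 0 = A₃ 0 = 1 and, for all m,
--   A₁ (m + 1) = A₂ (m + 1) + q^{3m+1} A₁ m,
--   A₂ (m + 1) = A₃ (m + 1) + q^{3m+2} A₃ m,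
--   A₃ (m + 2) = q^{3m+6} A₁ (m + 2) + q^{6m+9} A₁ (m + 1) + q^{6m+8} A₃ m,   A₃ 1 = q³ A₁ 1 + q³ A₁ 0.
-- Eliminating A₂ and A₃ gives A₁ (m + 1) = q^{3m+3} A₁ (m + 1) + (earlier terms), so these recurrences
-- determine A₁.
--
-- On the left, Aₖ m is the generating function of the counted partitions into m parts with smallest part ≥ k.
-- The recurrences come from removing the smallest part: after a part 1, 2 or 5 the admissible next parts are
-- exactly those ≥ 4, ≥ 6 or ≥ 9, after a part 3 they are 5 and those ≥ 7, and adding 3 to each of m parts
-- adds 3m to the weight.
--
-- On the right, with T a b the summand for (n₁, n₂) = (a, b), the triple is Σ_{a+2b=m} q^{c a b} T a b for
-- c = 0, a + 3b and 2a + 3b. The recurrences follow from the q-difference equations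
--   (1 - q^{a+1}) T (a + 1) b = q^{4a+6b+1} T a b   and   (1 - q^{3b+3}) T a (b + 1) = q^{6a+12b+5} T a b,
-- after reindexing the sums over a + 2b = m.

module Submission where

open import Defs
open import Data.Integer using (+_)
open import Data.Nat using (ℕ; zero; suc; _≤ᵇ_)
open import Relation.Binary.PropositionalEquality using (_≡_; refl; cong)

≤ᵇ-suc : ∀ m n → (suc m ≤ᵇ suc n) ≡ (m ≤ᵇ n)
≤ᵇ-suc zero    n = refl
≤ᵇ-suc (suc m) n = refl

module PowerSeries where

  open import Data.Integer using (ℤ; +_; -_; _+_; _*_; _-_)
  import Data.Integer.Properties as ℤP
  import Data.Integer.Tactic.RingSolver as ℤ-Ring
  open import Data.Bool using (true; false; if_then_else_)
  open import Data.List using (_∷_; map; upTo; applyUpTo; zipWith)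
  open import Data.List.Properties using (map-upTo)
  open import Data.Nat as ℕ using (ℕ; zero; suc; _∸_; _<_; _≤ᵇ_)
  import Data.Nat.Properties as ℕP
  open import Algebra.Properties.CommutativeSemigroup ℤP.+-commutativeSemigroup
    using () renaming (interchange to +-interchange)
  open import Data.Nat.Induction using (<-rec)
  open import Function using (_∘_; id)
  open import Relation.Binary.Bundles using (Setoid)
  open import Relation.Binary.PropositionalEquality
  open ≡-Reasoning

  Σℤ : ℕ → (ℕ → ℤ) → ℤ
  Σℤ zero    f = + 0
  Σℤ (suc n) f = f 0 + Σℤ n (f ∘ suc)

  Σℤ-cong : ∀ n {f g : ℕ → ℤ} → (∀ i → f i ≡ g i) → Σℤ n f ≡ Σℤ n g
  Σℤ-cong zero    e = refl
  Σℤ-cong (suc n) e = cong₂ _+_ (e 0) (Σℤ-cong n (e ∘ suc))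

  Σℤ-+ : ∀ n f g → Σℤ n (λ i → f i + g i) ≡ Σℤ n f + Σℤ n g
  Σℤ-+ zero    f g = refl
  Σℤ-+ (suc n) f g = trans (cong (_+_ (f 0 + g 0)) (Σℤ-+ n (f ∘ suc) (g ∘ suc)))
                           (+-interchange (f 0) (g 0) _ _)

  Σℤ-neg : ∀ n f → Σℤ n (λ i → - f i) ≡ - Σℤ n f
  Σℤ-neg zero    f = refl
  Σℤ-neg (suc n) f = trans (cong (_+_ (- f 0)) (Σℤ-neg n (f ∘ suc)))
                           (sym (ℤP.neg-distrib-+ (f 0) _))

  Σℤ-*ˡ : ∀ n c f → Σℤ n (λ i → c * f i) ≡ c * Σℤ n f
  Σℤ-*ˡ zero    c f = sym (ℤP.*-zeroʳ c)
  Σℤ-*ˡ (suc n) c f = trans (cong (_+_ (c * f 0)) (Σℤ-*ˡ n c (f ∘ suc)))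
                            (sym (ℤP.*-distribˡ-+ c (f 0) _))

  Σℤ-zero : ∀ n f → (∀ i → f i ≡ + 0) → Σℤ n f ≡ + 0
  Σℤ-zero zero    f e = refl
  Σℤ-zero (suc n) f e = cong₂ _+_ (e 0) (Σℤ-zero n (f ∘ suc) (e ∘ suc))

  Σℤ-last : ∀ n f → Σℤ (suc n) f ≡ Σℤ n f + f n
  Σℤ-last zero    f = trans (ℤP.+-identityʳ (f 0)) (sym (ℤP.+-identityˡ (f 0)))
  Σℤ-last (suc n) f = trans (cong (_+_ (f 0)) (Σℤ-last n (f ∘ suc))) (sym (ℤP.+-assoc (f 0) _ _))

  sumℤ-applyUpTo : ∀ n f → sumℤ (applyUpTo f n) ≡ Σℤ n f
  sumℤ-applyUpTo zero    f = refl
  sumℤ-applyUpTo (suc n) f = cong (_+_ (f 0)) (sumℤ-applyUpTo n (f ∘ suc))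

  sumℤ-map-upTo : ∀ n f → sumℤ (map f (upTo n)) ≡ Σℤ n f
  sumℤ-map-upTo n f = trans (cong sumℤ (map-upTo f n)) (sumℤ-applyUpTo n f)

  infix 4 _≈_
  _≈_ : Series → Series → Set
  f ≈ g = ∀ k → f k ≡ g k

  ≈-refl : ∀ {f} → f ≈ f
  ≈-refl k = refl

  ≈-sym : ∀ {f g} → f ≈ g → g ≈ f
  ≈-sym e k = sym (e k)

  ≈-trans : ∀ {f g h} → f ≈ g → g ≈ h → f ≈ h
  ≈-trans e e′ k = trans (e k) (e′ k)

  ≈-setoid : Setoid _ _
  ≈-setoid = record
    { Carrier       = Series
    ; _≈_           = _≈_
    ; isEquivalence = record { refl = λ {f} → ≈-refl {f} ; sym = ≈-sym ; trans = ≈-trans }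
    }

  0S : Series
  0S _ = + 0

  infixl 6 _+S_
  _+S_ : Series → Series → Series
  (f +S g) k = f k + g k

  negS : Series → Series
  negS f k = - f k

  _·S_ : ℤ → Series → Series
  (c ·S f) k = c * f k

  constS : ℤ → Series
  constS c zero    = c
  constS c (suc _) = + 0

  tailS : Series → Series
  tailS f = f ∘ suc

  shift₁ : Series → Series
  shift₁ f zero    = + 0
  shift₁ f (suc k) = f k

  +S-cong : ∀ {f f′ g g′} → f ≈ f′ → g ≈ g′ → f +S g ≈ f′ +S g′
  +S-cong e e′ k = cong₂ _+_ (e k) (e′ k)

  -S-cong : ∀ {f f′ g g′} → f ≈ f′ → g ≈ g′ → f -S g ≈ f′ -S g′
  -S-cong e e′ k = cong₂ _-_ (e k) (e′ k)

  shift₁-cong : ∀ {f g} → f ≈ g → shift₁ f ≈ shift₁ g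
  shift₁-cong e zero    = refl
  shift₁-cong e (suc k) = e k

  const+shift₁-tail : ∀ f → f ≈ constS (f 0) +S shift₁ (tailS f)
  const+shift₁-tail f zero    = sym (ℤP.+-identityʳ (f 0))
  const+shift₁-tail f (suc k) = sym (ℤP.+-identityˡ (f (suc k)))

  oneS≈const1 : oneS ≈ constS (+ 1)
  oneS≈const1 zero    = refl
  oneS≈const1 (suc k) = refl

  *S-Σ : ∀ f g k → (f *S g) k ≡ Σℤ (suc k) (λ i → f i * g (k ∸ i))
  *S-Σ f g k = sumℤ-map-upTo (suc k) (λ i → f i * g (k ∸ i))

  *S-suc : ∀ f g k → (f *S g) (suc k) ≡ f 0 * g (suc k) + (tailS f *S g) k
  *S-suc f g k = trans (*S-Σ f g (suc k)) (cong (_+_ (f 0 * g (suc k))) (sym (*S-Σ (tailS f) g k)))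

  *S-cong : ∀ {f f′ g g′} → f ≈ f′ → g ≈ g′ → f *S g ≈ f′ *S g′
  *S-cong {f} {f′} {g} {g′} e e′ k = begin
    (f *S g) k
      ≡⟨ *S-Σ f g k ⟩
    Σℤ (suc k) (λ i → f i * g (k ∸ i))
      ≡⟨ Σℤ-cong (suc k) (λ i → cong₂ _*_ (e i) (e′ (k ∸ i))) ⟩
    Σℤ (suc k) (λ i → f′ i * g′ (k ∸ i))
      ≡⟨ *S-Σ f′ g′ k ⟨
    (f′ *S g′) k ∎

  *S-distribʳ-+S : ∀ h f g → (f +S g) *S h ≈ (f *S h) +S (g *S h)
  *S-distribʳ-+S h f g k = begin
    ((f +S g) *S h) k
      ≡⟨ *S-Σ (f +S g) h k ⟩
    Σℤ (suc k) (λ i → (f i + g i) * h (k ∸ i))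
      ≡⟨ Σℤ-cong (suc k) (λ i → ℤP.*-distribʳ-+ (h (k ∸ i)) (f i) (g i)) ⟩
    Σℤ (suc k) (λ i → f i * h (k ∸ i) + g i * h (k ∸ i))
      ≡⟨ Σℤ-+ (suc k) (λ i → f i * h (k ∸ i)) (λ i → g i * h (k ∸ i)) ⟩
    Σℤ (suc k) (λ i → f i * h (k ∸ i)) + Σℤ (suc k) (λ i → g i * h (k ∸ i))
      ≡⟨ cong₂ _+_ (*S-Σ f h k) (*S-Σ g h k) ⟨
    ((f *S h) +S (g *S h)) k ∎

  *S-distribˡ-+S : ∀ h f g → h *S (f +S g) ≈ (h *S f) +S (h *S g)
  *S-distribˡ-+S h f g k = begin
    (h *S (f +S g)) k
      ≡⟨ *S-Σ h (f +S g) k ⟩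
    Σℤ (suc k) (λ i → h i * (f (k ∸ i) + g (k ∸ i)))
      ≡⟨ Σℤ-cong (suc k) (λ i → ℤP.*-distribˡ-+ (h i) (f (k ∸ i)) (g (k ∸ i))) ⟩
    Σℤ (suc k) (λ i → h i * f (k ∸ i) + h i * g (k ∸ i))
      ≡⟨ Σℤ-+ (suc k) (λ i → h i * f (k ∸ i)) (λ i → h i * g (k ∸ i)) ⟩
    Σℤ (suc k) (λ i → h i * f (k ∸ i)) + Σℤ (suc k) (λ i → h i * g (k ∸ i))
      ≡⟨ cong₂ _+_ (*S-Σ h f k) (*S-Σ h g k) ⟨
    ((h *S f) +S (h *S g)) k ∎

  *S-negˡ : ∀ f g → negS f *S g ≈ negS (f *S g)
  *S-negˡ f g k = begin
    (negS f *S g) k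
      ≡⟨ *S-Σ (negS f) g k ⟩
    Σℤ (suc k) (λ i → - f i * g (k ∸ i))
      ≡⟨ Σℤ-cong (suc k) (λ i → ℤP.neg-distribˡ-* (f i) (g (k ∸ i))) ⟨
    Σℤ (suc k) (λ i → - (f i * g (k ∸ i)))
      ≡⟨ Σℤ-neg (suc k) (λ i → f i * g (k ∸ i)) ⟩
    - Σℤ (suc k) (λ i → f i * g (k ∸ i))
      ≡⟨ cong -_ (*S-Σ f g k) ⟨
    negS (f *S g) k ∎

  *S-scaleˡ : ∀ c f g → (c ·S f) *S g ≈ c ·S (f *S g)
  *S-scaleˡ c f g k = begin
    ((c ·S f) *S g) k
      ≡⟨ *S-Σ (c ·S f) g k ⟩
    Σℤ (suc k) (λ i → c * f i * g (k ∸ i))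
      ≡⟨ Σℤ-cong (suc k) (λ i → ℤP.*-assoc c (f i) (g (k ∸ i))) ⟩
    Σℤ (suc k) (λ i → c * (f i * g (k ∸ i)))
      ≡⟨ Σℤ-*ˡ (suc k) c (λ i → f i * g (k ∸ i)) ⟩
    c * Σℤ (suc k) (λ i → f i * g (k ∸ i))
      ≡⟨ cong (c *_) (*S-Σ f g k) ⟨
    (c ·S (f *S g)) k ∎

  *S-zeroˡ : ∀ g → 0S *S g ≈ 0S
  *S-zeroˡ g zero    = refl
  *S-zeroˡ g (suc k) = trans (*S-suc 0S g k) (cong (_+_ (+ 0 * g (suc k))) (*S-zeroˡ g k))

  *S-shift₁ˡ : ∀ f g → shift₁ f *S g ≈ shift₁ (f *S g)
  *S-shift₁ˡ f g zero    = refl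
  *S-shift₁ˡ f g (suc k) = trans (*S-suc (shift₁ f) g k) (ℤP.+-identityˡ _)

  *S-constˡ : ∀ c g → constS c *S g ≈ c ·S g
  *S-constˡ c g zero    = ℤP.+-identityʳ _
  *S-constˡ c g (suc k) = begin
    (constS c *S g) (suc k)         ≡⟨ *S-suc (constS c) g k ⟩
    c * g (suc k) + (0S *S g) k     ≡⟨ cong (_+_ (c * g (suc k))) (*S-zeroˡ g k) ⟩
    c * g (suc k) + + 0             ≡⟨ ℤP.+-identityʳ _ ⟩
    c * g (suc k)                   ∎

  *S-shift₁ʳ : ∀ f g → f *S shift₁ g ≈ shift₁ (f *S g)
  *S-shift₁ʳ f g zero          = trans (ℤP.+-identityʳ _) (ℤP.*-zeroʳ (f 0))
  *S-shift₁ʳ f g (suc zero)    = trans (*S-suc f (shift₁ g) 0)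
                                       (cong (_+_ (f 0 * g 0)) (*S-shift₁ʳ (tailS f) g 0))
  *S-shift₁ʳ f g (suc (suc k)) = begin
    (f *S shift₁ g) (suc (suc k))
      ≡⟨ *S-suc f (shift₁ g) (suc k) ⟩
    f 0 * g (suc k) + (tailS f *S shift₁ g) (suc k)
      ≡⟨ cong (_+_ (f 0 * g (suc k))) (*S-shift₁ʳ (tailS f) g (suc k)) ⟩
    f 0 * g (suc k) + (tailS f *S g) k
      ≡⟨ *S-suc f g k ⟨
    (f *S g) (suc k) ∎

  *S-constʳ : ∀ f c → (f *S constS c) ≈ (λ k → f k * c)
  *S-constʳ f c zero    = ℤP.+-identityʳ _
  *S-constʳ f c (suc k) = begin
    (f *S constS c) (suc k)
      ≡⟨ *S-suc f (constS c) k ⟩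
    f 0 * + 0 + (tailS f *S constS c) k
      ≡⟨ cong₂ _+_ (ℤP.*-zeroʳ (f 0)) (*S-constʳ (tailS f) c k) ⟩
    + 0 + f (suc k) * c
      ≡⟨ ℤP.+-identityˡ _ ⟩
    f (suc k) * c ∎

  *S-comm : ∀ f g → f *S g ≈ g *S f
  *S-comm f g zero    = cong (λ x → x + + 0) (ℤP.*-comm (f 0) (g 0))
  *S-comm f g (suc k) = begin
    (f *S g) (suc k)
      ≡⟨ *S-suc f g k ⟩
    f 0 * g (suc k) + (tailS f *S g) k
      ≡⟨ cong₂ _+_ (ℤP.*-comm (f 0) (g (suc k))) (*S-comm (tailS f) g k) ⟩
    g (suc k) * f 0 + (g *S tailS f) k
      ≡⟨ cong₂ _+_ (*S-constʳ g (f 0) (suc k)) (*S-shift₁ʳ g (tailS f) (suc k)) ⟨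
    (g *S constS (f 0) +S g *S shift₁ (tailS f)) (suc k)
      ≡⟨ *S-distribˡ-+S g (constS (f 0)) (shift₁ (tailS f)) (suc k) ⟨
    (g *S (constS (f 0) +S shift₁ (tailS f))) (suc k)
      ≡⟨ *S-cong (≈-refl {g}) (const+shift₁-tail f) (suc k) ⟨
    (g *S f) (suc k) ∎

  *S-head-tail : ∀ f g → f *S g ≈ (f 0 ·S g) +S shift₁ (tailS f *S g)
  *S-head-tail f g = ≈-trans (*S-cong (const+shift₁-tail f) (≈-refl {g}))
    (≈-trans (*S-distribʳ-+S g (constS (f 0)) (shift₁ (tailS f)))
             (+S-cong (*S-constˡ (f 0) g) (*S-shift₁ˡ (tailS f) g)))

  *S-assoc : ∀ f g h → f *S (g *S h) ≈ (f *S g) *S h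
  *S-assoc f g h zero    = assoc₀ (f 0) (g 0) (h 0)
    where
    assoc₀ : ∀ a b c → a * (b * c + + 0) + + 0 ≡ (a * b + + 0) * c + + 0
    assoc₀ = ℤ-Ring.solve-∀
  *S-assoc f g h (suc k) = begin
    (f *S (g *S h)) (suc k)
      ≡⟨ *S-suc f (g *S h) k ⟩
    f 0 * (g *S h) (suc k) + (tailS f *S (g *S h)) k
      ≡⟨ cong (_+_ (f 0 * (g *S h) (suc k))) (*S-assoc (tailS f) g h k) ⟩
    ((f 0 ·S (g *S h)) +S shift₁ ((tailS f *S g) *S h)) (suc k)
      ≡⟨ +S-cong (*S-scaleˡ (f 0) g h) (*S-shift₁ˡ (tailS f *S g) h) (suc k) ⟨
    ((f 0 ·S g) *S h +S shift₁ (tailS f *S g) *S h) (suc k)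
      ≡⟨ *S-distribʳ-+S h (f 0 ·S g) (shift₁ (tailS f *S g)) (suc k) ⟨
    (((f 0 ·S g) +S shift₁ (tailS f *S g)) *S h) (suc k)
      ≡⟨ *S-cong (*S-head-tail f g) (≈-refl {h}) (suc k) ⟨
    ((f *S g) *S h) (suc k) ∎

  *S-identityˡ : ∀ g → oneS *S g ≈ g
  *S-identityˡ g k = trans (*S-cong oneS≈const1 (≈-refl {g}) k)
                           (trans (*S-constˡ (+ 1) g k) (ℤP.*-identityˡ (g k)))

  *S-identityʳ : ∀ g → g *S oneS ≈ g
  *S-identityʳ g = ≈-trans (*S-comm g oneS) (*S-identityˡ g)

  shift : ℕ → Series → Series
  shift zero    f = f
  shift (suc e) f = shift₁ (shift e f)

  shift-cong : ∀ e {f g} → f ≈ g → shift e f ≈ shift e g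
  shift-cong zero    x = x
  shift-cong (suc e) x = shift₁-cong (shift-cong e x)

  shift-≡ : ∀ {c d} f → c ≡ d → shift c f ≈ shift d f
  shift-≡ f refl = ≈-refl

  shift-+ : ∀ a b f → shift (a ℕ.+ b) f ≈ shift a (shift b f)
  shift-+ zero    b f = ≈-refl
  shift-+ (suc a) b f = shift₁-cong (shift-+ a b f)

  shift-if : ∀ e f n → shift e f n ≡ (if e ≤ᵇ n then f (n ∸ e) else + 0)
  shift-if zero    f n       = refl
  shift-if (suc e) f zero    = refl
  shift-if (suc e) f (suc n) = trans (shift-if e f n)
    (cong (λ b → if b then f (n ∸ e) else + 0) (sym (≤ᵇ-suc e n)))

  shift-0S : ∀ e → shift e 0S ≈ 0S
  shift-0S e n = trans (shift-if e 0S n) (lemma (e ≤ᵇ n))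
    where
    lemma : ∀ b → (if b then + 0 else + 0) ≡ + 0
    lemma true  = refl
    lemma false = refl

  shift-+S : ∀ e f g → shift e (f +S g) ≈ shift e f +S shift e g
  shift-+S e f g n = trans (shift-if e (f +S g) n)
    (trans (lemma (e ≤ᵇ n)) (sym (cong₂ _+_ (shift-if e f n) (shift-if e g n))))
    where
    lemma : ∀ b → (if b then f (n ∸ e) + g (n ∸ e) else + 0)
                ≡ (if b then f (n ∸ e) else + 0) + (if b then g (n ∸ e) else + 0)
    lemma true  = refl
    lemma false = refl

  shift--S : ∀ e f g → shift e (f -S g) ≈ shift e f -S shift e g
  shift--S e f g n = trans (shift-if e (f -S g) n)
    (trans (lemma (e ≤ᵇ n)) (sym (cong₂ _-_ (shift-if e f n) (shift-if e g n))))
    where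
    lemma : ∀ b → (if b then f (n ∸ e) - g (n ∸ e) else + 0)
                ≡ (if b then f (n ∸ e) else + 0) - (if b then g (n ∸ e) else + 0)
    lemma true  = refl
    lemma false = refl

  *S-shiftˡ : ∀ e f g → shift e f *S g ≈ shift e (f *S g)
  *S-shiftˡ zero    f g = ≈-refl
  *S-shiftˡ (suc e) f g = ≈-trans (*S-shift₁ˡ (shift e f) g) (shift₁-cong (*S-shiftˡ e f g))

  ^S-qS : ∀ e → qS ^S e ≈ shift e oneS
  ^S-qS zero    = ≈-refl
  ^S-qS (suc e) = ≈-trans (*S-cong q≈shift₁-one (^S-qS e))
    (≈-trans (*S-shift₁ˡ oneS (shift e oneS)) (shift₁-cong (*S-identityˡ (shift e oneS))))
    where
    q≈shift₁-one : qS ≈ shift₁ oneS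
    q≈shift₁-one zero          = refl
    q≈shift₁-one (suc zero)    = refl
    q≈shift₁-one (suc (suc k)) = refl

  ^S-+ : ∀ f a b → f ^S (a ℕ.+ b) ≈ (f ^S a) *S (f ^S b)
  ^S-+ f zero    b = ≈-sym (*S-identityˡ (f ^S b))
  ^S-+ f (suc a) b = ≈-trans (*S-cong (≈-refl {f}) (^S-+ f a b)) (*S-assoc f (f ^S a) (f ^S b))

  ^S-* : ∀ f a n → (f ^S a) ^S n ≈ f ^S (a ℕ.* n)
  ^S-* f a zero    k = cong (λ e → (f ^S e) k) (sym (ℕP.*-zeroʳ a))
  ^S-* f a (suc n) = ≈-trans (*S-cong (≈-refl {f ^S a}) (^S-* f a n))
    (≈-trans (≈-sym (^S-+ f a (a ℕ.* n))) (λ k → cong (λ e → (f ^S e) k) (sym (ℕP.*-suc a n))))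

  *S-qpow : ∀ e f → (qS ^S e) *S f ≈ shift e f
  *S-qpow e f = ≈-trans (*S-cong (^S-qS e) (≈-refl {f}))
    (≈-trans (*S-shiftˡ e oneS f) (shift-cong e (*S-identityˡ f)))

  Δ : ℕ → Series → Series
  Δ e f = f -S shift e f

  Δ-zero : ∀ f → Δ 0 f ≈ 0S
  Δ-zero f k = ℤP.+-inverseʳ (f k)

  shift-Δ : ∀ c e f → shift c f -S shift (c ℕ.+ e) f ≈ shift c (Δ e f)
  shift-Δ c e f = ≈-trans (-S-cong (≈-refl {shift c f}) (shift-+ c e f))
                          (≈-sym (shift--S c f (shift e f)))

  Δ-+ : ∀ a e f → Δ (a ℕ.+ e) f ≈ Δ a f +S shift a (Δ e f)
  Δ-+ a e f k = trans (telescope (f k) (shift a f k) (shift (a ℕ.+ e) f k))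
                      (cong (_+_ (Δ a f k)) (shift-Δ a e f k))
    where
    telescope : ∀ x y z → x - z ≡ (x - y) + (y - z)
    telescope = ℤ-Ring.solve-∀

  *S-Δ : ∀ e f → (oneS -S (qS ^S e)) *S f ≈ Δ e f
  *S-Δ e f = ≈-trans (*S-distribʳ-+S f oneS (negS (qS ^S e)))
    (+S-cong (*S-identityˡ f) (≈-trans (*S-negˡ (qS ^S e) f) (λ k → cong -_ (*S-qpow e f k))))

  invRev≡applyUpTo : ∀ f k → invRev f k ≡ applyUpTo (λ i → invS f (k ∸ i)) (suc k)
  invRev≡applyUpTo f zero    = refl
  invRev≡applyUpTo f (suc k) = cong (invS f (suc k) ∷_) (invRev≡applyUpTo f k)

  zipWith-applyUpTo : ∀ {A B C : Set} (h : A → B → C) a b n →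
    zipWith h (applyUpTo a n) (applyUpTo b n) ≡ applyUpTo (λ i → h (a i) (b i)) n
  zipWith-applyUpTo h a b zero    = refl
  zipWith-applyUpTo h a b (suc n) = cong (h (a 0) (b 0) ∷_) (zipWith-applyUpTo h (a ∘ suc) (b ∘ suc) n)

  invS-suc : ∀ f k → invS f (suc k) ≡ - (tailS f *S invS f) k
  invS-suc f k = cong -_ (begin
    sumℤ (zipWith (λ i gi → f (suc i) * gi) (upTo (suc k)) (invRev f k))
      ≡⟨ cong (λ l → sumℤ (zipWith (λ i gi → f (suc i) * gi) (upTo (suc k)) l)) (invRev≡applyUpTo f k) ⟩
    sumℤ (zipWith (λ i gi → f (suc i) * gi) (upTo (suc k)) (applyUpTo (λ i → invS f (k ∸ i)) (suc k)))
      ≡⟨ cong sumℤ (zipWith-applyUpTo (λ i gi → f (suc i) * gi) id (λ i → invS f (k ∸ i)) (suc k)) ⟩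
    sumℤ (applyUpTo (λ i → f (suc i) * invS f (k ∸ i)) (suc k))
      ≡⟨ sumℤ-applyUpTo (suc k) (λ i → f (suc i) * invS f (k ∸ i)) ⟩
    Σℤ (suc k) (λ i → f (suc i) * invS f (k ∸ i))
      ≡⟨ *S-Σ (tailS f) (invS f) k ⟨
    (tailS f *S invS f) k ∎)

  *S-invS : ∀ f → f 0 ≡ + 1 → f *S invS f ≈ oneS
  *S-invS f f₀≡1 zero    rewrite f₀≡1 = refl
  *S-invS f f₀≡1 (suc k) = begin
    (f *S invS f) (suc k)
      ≡⟨ *S-suc f (invS f) k ⟩
    f 0 * invS f (suc k) + (tailS f *S invS f) k
      ≡⟨ cong₂ (λ a b → a * b + (tailS f *S invS f) k) f₀≡1 (invS-suc f k) ⟩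
    + 1 * - (tailS f *S invS f) k + (tailS f *S invS f) k
      ≡⟨ cancel ((tailS f *S invS f) k) ⟩
    + 0 ∎
    where
    cancel : ∀ s → + 1 * - s + s ≡ + 0
    cancel = ℤ-Ring.solve-∀

  inverse-unique : ∀ f h g → f *S h ≈ oneS → f *S g ≈ oneS → h ≈ g
  inverse-unique f h g fh≈1 fg≈1 =
    ≈-trans (≈-sym (*S-identityʳ h))
    (≈-trans (*S-cong (≈-refl {h}) (≈-sym fg≈1))
    (≈-trans (*S-assoc h f g)
    (≈-trans (*S-cong (≈-trans (*S-comm h f) fh≈1) (≈-refl {g}))
             (*S-identityˡ g))))

  shift-comm : ∀ a b f → shift a (shift b f) ≈ shift b (shift a f)
  shift-comm a b f =
    ≈-trans (≈-sym (shift-+ a b f)) (≈-trans (shift-≡ f (ℕP.+-comm a b)) (shift-+ b a f))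

  Δ-cong : ∀ j {f g} → f ≈ g → Δ j f ≈ Δ j g
  Δ-cong j e = -S-cong e (shift-cong j e)

  Δ-shift : ∀ j e f → Δ j (shift e f) ≈ shift e (Δ j f)
  Δ-shift j e f =
    ≈-trans (-S-cong (≈-refl {shift e f}) (shift-comm j e f)) (≈-sym (shift--S e f (shift j f)))

  Δ-invS : ∀ j f g → f 0 ≡ + 1 → g 0 ≡ + 1 → g ≈ f *S (oneS -S (qS ^S j)) →
           Δ j (invS g) ≈ invS f
  Δ-invS j f g f₀≡1 g₀≡1 g≈f[1-qʲ] = inverse-unique f (Δ j (invS g)) (invS f)
    (≈-trans (*S-cong (≈-refl {f}) (≈-sym (*S-Δ j (invS g))))
    (≈-trans (*S-assoc f (oneS -S (qS ^S j)) (invS g))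
    (≈-trans (*S-cong (≈-sym g≈f[1-qʲ]) (≈-refl {invS g})) (*S-invS g g₀≡1))))
    (*S-invS f f₀≡1)

  from-difference : ∀ {x y z} → x -S y ≈ z → x ≈ y +S z
  from-difference {x} {y} x-y≈z k = trans (split (x k) (y k)) (cong (_+_ (y k)) (x-y≈z k))
    where
    split : ∀ a b → a ≡ b + (a - b)
    split = ℤ-Ring.solve-∀

  from-difference-telescoped : ∀ {x y u v t} → x -S y ≈ u +S v → t -S u ≈ v → x ≈ y +S t
  from-difference-telescoped {x} {y} {u} {v} {t} x-y≈u+v t-u≈v k = begin
    x k                       ≡⟨ from-difference {x} {y} x-y≈u+v k ⟩
    y k + (u k + v k)         ≡⟨ cong (λ w → y k + (u k + w)) (t-u≈v k) ⟨
    y k + (u k + (t k - u k)) ≡⟨ cancel (y k) (u k) (t k) ⟩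
    y k + t k                 ∎
    where
    cancel : ∀ y u t → y + (u + (t - u)) ≡ y + t
    cancel = ℤ-Ring.solve-∀

  subtrahend-from-difference : ∀ {x y z} → x -S y ≈ z → y ≈ x -S z
  subtrahend-from-difference {x} {y} x-y≈z k = trans (swap (x k) (y k)) (cong (_-_ (x k)) (x-y≈z k))
    where
    swap : ∀ a b → b ≡ a - (a - b)
    swap = ℤ-Ring.solve-∀

  from-difference-split : ∀ {x t u v t₁ t₂ w} → x -S t ≈ u +S v → u -S t₁ ≈ w → t₂ -S v ≈ w →
                          x ≈ t +S (t₁ +S t₂)
  from-difference-split {x} {t} {u} {v} {t₁} {t₂} {w} x-t≈u+v u-t₁≈w t₂-v≈w k = begin
    x k
      ≡⟨ from-difference {x} {t} x-t≈u+v k ⟩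
    t k + (u k + v k)
      ≡⟨ cong₂ (λ p r → t k + (p + r)) (from-difference {u} {t₁} u-t₁≈w k)
                                       (subtrahend-from-difference {t₂} {v} t₂-v≈w k) ⟩
    t k + ((t₁ k + w k) + (t₂ k - w k))
      ≡⟨ cancel (t k) (t₁ k) (t₂ k) (w k) ⟩
    t k + (t₁ k + t₂ k) ∎
    where
    cancel : ∀ t t₁ t₂ w → t + ((t₁ + w) + (t₂ - w)) ≡ t + (t₁ + t₂)
    cancel = ℤ-Ring.solve-∀

  from-difference-vanishing : ∀ {x t u v t₁} → x -S t ≈ u +S v → u -S t₁ ≈ 0S → v ≈ 0S →
                              x ≈ t +S t₁
  from-difference-vanishing {x} {t} {u} {v} {t₁} x-t≈u+v u-t₁≈0 v≈0 k = begin
    x k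
      ≡⟨ from-difference {x} {t} x-t≈u+v k ⟩
    t k + (u k + v k)
      ≡⟨ cong₂ (λ p r → t k + (p + r)) (from-difference {u} {t₁} u-t₁≈0 k) (v≈0 k) ⟩
    t k + ((t₁ k + + 0) + + 0)
      ≡⟨ cancel (t k) (t₁ k) ⟩
    t k + t₁ k ∎
    where
    cancel : ∀ t t₁ → t + ((t₁ + + 0) + + 0) ≡ t + t₁
    cancel = ℤ-Ring.solve-∀

  substitute-twice : ∀ {x y z s c₁ c₂ c₃} → x ≈ y +S c₁ → y ≈ z +S c₂ → z ≈ s +S c₃ →
                     x ≈ s +S (c₃ +S c₂ +S c₁)
  substitute-twice {x} {y} {z} {s} {c₁} {c₂} {c₃} x≈ y≈ z≈ k = begin
    x k                         ≡⟨ x≈ k ⟩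
    y k + c₁ k                  ≡⟨ cong (_+ c₁ k) (trans (y≈ k) (cong (_+ c₂ k) (z≈ k))) ⟩
    s k + c₃ k + c₂ k + c₁ k    ≡⟨ reassociate (s k) (c₃ k) (c₂ k) (c₁ k) ⟩
    s k + (c₃ k + c₂ k + c₁ k)  ∎
    where
    reassociate : ∀ s a b c → s + a + b + c ≡ s + (a + b + c)
    reassociate = ℤ-Ring.solve-∀

  shift-suc-agree-below : ∀ e n {f g} → (∀ k → k < n → f k ≡ g k) →
                          shift (suc e) f n ≡ shift (suc e) g n
  shift-suc-agree-below e       zero    f≡g = refl
  shift-suc-agree-below zero    (suc n) f≡g = f≡g n (ℕP.n<1+n n)
  shift-suc-agree-below (suc e) (suc n) f≡g =
    shift-suc-agree-below e n (λ k k<n → f≡g k (ℕP.m<n⇒m<1+n k<n))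

  shift-fixpoint-unique : ∀ e {x y c} → 0 < e → x ≈ shift e x +S c → y ≈ shift e y +S c → x ≈ y
  shift-fixpoint-unique (suc e) {x} {y} {c} _ x≈ y≈ = <-rec (λ n → x n ≡ y n) step
    where
    step : ∀ n → (∀ {k} → k < n → x k ≡ y k) → x n ≡ y n
    step n x≡y-below =
      trans (x≈ n) (trans (cong (_+ c n) (shift-suc-agree-below e n (λ k → x≡y-below {k}))) (sym (y≈ n)))

  shift-merge : ∀ a b {c} f → a ℕ.+ b ≡ c → shift a (shift b f) ≈ shift c f
  shift-merge a b f a+b≡c = ≈-trans (≈-sym (shift-+ a b f)) (shift-≡ f a+b≡c)

open PowerSeries

module RecurrenceSystem where

  open import Data.Nat as ℕ using (ℕ; zero; suc; _+_; _*_)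
  open import Data.Product using (_×_; _,_; proj₁)

  record Recurrences (A₁ A₂ A₃ : ℕ → Series) : Set where
    field
      init₁     : A₁ 0 ≈ oneS
      init₃     : A₃ 0 ≈ oneS
      step₁     : ∀ m → A₁ (suc m) ≈ A₂ (suc m) +S shift (3 * m + 1) (A₁ m)
      step₂     : ∀ m → A₂ (suc m) ≈ A₃ (suc m) +S shift (3 * m + 2) (A₃ m)
      step₃-one : A₃ 1 ≈ shift 3 (A₁ 1) +S shift 3 (A₁ 0)
      step₃     : ∀ m → A₃ (suc (suc m)) ≈ shift (3 * suc (suc m)) (A₁ (suc (suc m)))
                                            +S (shift (6 * suc m + 3) (A₁ (suc m)) +S shift (6 * m + 8) (A₃ m))

  module _ {A₁ A₂ A₃ B₁ B₂ B₃ : ℕ → Series}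
           (A : Recurrences A₁ A₂ A₃) (B : Recurrences B₁ B₂ B₃) where

    private
      module A = Recurrences A
      module B = Recurrences B

    Agree : ℕ → Set
    Agree m = (A₁ m ≈ B₁ m) × (A₃ m ≈ B₃ m)

    agree-zero : Agree 0
    agree-zero = ≈-trans A.init₁ (≈-sym B.init₁) , ≈-trans A.init₃ (≈-sym B.init₃)

    agree-suc : ∀ m {Lᴬ Lᴮ} → Agree m → Lᴬ ≈ Lᴮ →
                A₃ (suc m) ≈ shift (3 * suc m) (A₁ (suc m)) +S Lᴬ →
                B₃ (suc m) ≈ shift (3 * suc m) (B₁ (suc m)) +S Lᴮ →
                Agree (suc m)
    agree-suc m {Lᴬ} {Lᴮ} (A₁≈B₁ , A₃≈B₃) Lᴬ≈Lᴮ A₃-step B₃-step =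
      A₁≈B₁′ ,
      ≈-trans A₃-step (≈-trans (+S-cong (shift-cong (3 * suc m) A₁≈B₁′) Lᴬ≈Lᴮ) (≈-sym B₃-step))
      where
      lower≈ : Lᴬ +S shift (3 * m + 2) (A₃ m) +S shift (3 * m + 1) (A₁ m)
             ≈ Lᴮ +S shift (3 * m + 2) (B₃ m) +S shift (3 * m + 1) (B₁ m)
      lower≈ = +S-cong (+S-cong Lᴬ≈Lᴮ (shift-cong (3 * m + 2) A₃≈B₃))
                       (shift-cong (3 * m + 1) A₁≈B₁)
      A₁≈B₁′ : A₁ (suc m) ≈ B₁ (suc m)
      A₁≈B₁′ = shift-fixpoint-unique (3 * suc m) ℕ.z<s
        (substitute-twice {s = shift (3 * suc m) (A₁ (suc m))} {c₃ = Lᴬ}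
                          (A.step₁ m) (A.step₂ m) A₃-step)
        (≈-trans (substitute-twice {s = shift (3 * suc m) (B₁ (suc m))} {c₃ = Lᴮ}
                                   (B.step₁ m) (B.step₂ m) B₃-step)
                 (+S-cong (≈-refl {shift (3 * suc m) (B₁ (suc m))}) (≈-sym lower≈)))

    agree-pair : ∀ m → Agree m × Agree (suc m)
    agree-pair zero    =
      agree-zero , agree-suc 0 agree-zero (shift-cong 3 (proj₁ agree-zero)) A.step₃-one B.step₃-one
    agree-pair (suc m) with agree-pair m
    ... | (_ , A₃≈B₃) , agree-m+1@(A₁≈B₁′ , _) =
      agree-m+1 ,
      agree-suc (suc m) agree-m+1
                (+S-cong (shift-cong (6 * suc m + 3) A₁≈B₁′) (shift-cong (6 * m + 8) A₃≈B₃))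
                (A.step₃ m) (B.step₃ m)

    recurrences-unique : ∀ m → A₁ m ≈ B₁ m
    recurrences-unique m = proj₁ (proj₁ (agree-pair m))

open RecurrenceSystem

module Summands where

  open import Data.Integer using (+_)
  open import Data.Nat using (ℕ; zero; suc; _+_; _*_; _∸_; _≤_; z≤n)
  import Data.Nat.Properties as ℕP
  import Data.Nat.Tactic.RingSolver as ℕ-Ring
  open import Relation.Binary.PropositionalEquality

  poch-const : ∀ a p n → a 0 ≡ + 0 → poch a p n 0 ≡ + 1
  poch-const a p zero    a₀≡0 = refl
  poch-const a p (suc n) a₀≡0 rewrite poch-const a p n a₀≡0 | a₀≡0 = refl

  den : ℕ → ℕ → Series
  den a b = poch qS qS a *S poch (qS ^S 3) (qS ^S 3) b

  den-const : ∀ a b → den a b 0 ≡ + 1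
  den-const a b rewrite poch-const qS qS a refl | poch-const (qS ^S 3) (qS ^S 3) b refl = refl

  den-suc₁ : ∀ a b → den (suc a) b ≈ den a b *S (oneS -S (qS ^S suc a))
  den-suc₁ a b =
    ≈-trans (≈-sym (*S-assoc A (oneS -S (qS ^S suc a)) B))
    (≈-trans (*S-cong (≈-refl {A}) (*S-comm (oneS -S (qS ^S suc a)) B))
             (*S-assoc A B (oneS -S (qS ^S suc a))))
    where
    A = poch qS qS a
    B = poch (qS ^S 3) (qS ^S 3) b

  den-suc₂ : ∀ a b → den a (suc b) ≈ den a b *S (oneS -S (qS ^S (3 * suc b)))
  den-suc₂ a b =
    ≈-trans (*S-cong (≈-refl {A}) (*S-cong (≈-refl {B}) (-S-cong (≈-refl {oneS}) (^S-* qS 3 (suc b)))))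
            (*S-assoc A B (oneS -S (qS ^S (3 * suc b))))
    where
    A = poch qS qS a
    B = poch (qS ^S 3) (qS ^S 3) b

  n≤suc[c]*n*n : ∀ c n → n ≤ suc c * n * n
  n≤suc[c]*n*n c zero    = z≤n
  n≤suc[c]*n*n c (suc n) =
    ℕP.≤-trans (ℕP.m≤m+n (suc n) (n * suc n + c * suc n * suc n)) (ℕP.≤-reflexive (expand c n))
    where
    expand : ∀ c n → suc n + (n * suc n + c * suc n * suc n) ≡ suc c * suc n * suc n
    expand = ℕ-Ring.solve-∀

  quadratic : ℕ → ℕ → ℕ
  quadratic a b = 6 * b * b + 2 * a * a + 6 * b * a

  -- adding back the two truncated subtractions of expo
  expo+a+b : ∀ a b → expo a b + (a + b) ≡ quadratic a b
  expo+a+b a b = trans (regroup (6 * b * b ∸ b) (2 * a * a ∸ a) (6 * b * a) a b)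
    (cong₂ (λ x y → x + y + 6 * b * a) (ℕP.m∸n+n≡m (n≤suc[c]*n*n 5 b))
                                        (ℕP.m∸n+n≡m (n≤suc[c]*n*n 1 a)))
    where
    regroup : ∀ x y z a b → x + y + z + (a + b) ≡ (x + b) + (y + a) + z
    regroup = ℕ-Ring.solve-∀

  expo-step : ∀ d a b a′ b′ → quadratic a′ b′ + (a + b) ≡ d + quadratic a b + (a′ + b′) →
              expo a′ b′ ≡ d + expo a b
  expo-step d a b a′ b′ quadratic≡ = ℕP.+-cancelʳ-≡ (a′ + b′ + (a + b)) _ _ (begin
    expo a′ b′ + (a′ + b′ + (a + b))          ≡⟨ ℕP.+-assoc (expo a′ b′) (a′ + b′) (a + b) ⟨
    expo a′ b′ + (a′ + b′) + (a + b)          ≡⟨ cong (_+ (a + b)) (expo+a+b a′ b′) ⟩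
    quadratic a′ b′ + (a + b)                 ≡⟨ quadratic≡ ⟩
    d + quadratic a b + (a′ + b′)             ≡⟨ cong (λ x → d + x + (a′ + b′)) (expo+a+b a b) ⟨
    d + (expo a b + (a + b)) + (a′ + b′)      ≡⟨ regroup d (expo a b) (a + b) (a′ + b′) ⟩
    d + expo a b + (a′ + b′ + (a + b))        ∎)
    where
    open ≡-Reasoning
    regroup : ∀ d e s s′ → d + (e + s) + s′ ≡ d + e + (s′ + s)
    regroup = ℕ-Ring.solve-∀

  expo-suc₁ : ∀ a b → expo (suc a) b ≡ (4 * a + 1 + 6 * b) + expo a b
  expo-suc₁ a b = expo-step (4 * a + 1 + 6 * b) a b (suc a) b (expand a b)
    where
    expand : ∀ a b → 6 * b * b + 2 * suc a * suc a + 6 * b * suc a + (a + b)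
                   ≡ 4 * a + 1 + 6 * b + (6 * b * b + 2 * a * a + 6 * b * a) + (suc a + b)
    expand = ℕ-Ring.solve-∀

  expo-suc₂ : ∀ a b → expo a (suc b) ≡ (12 * b + 6 * a + 5) + expo a b
  expo-suc₂ a b = expo-step (12 * b + 6 * a + 5) a b a (suc b) (expand a b)
    where
    expand : ∀ a b → 6 * suc b * suc b + 2 * a * a + 6 * suc b * a + (a + b)
                   ≡ 12 * b + 6 * a + 5 + (6 * b * b + 2 * a * a + 6 * b * a) + (a + suc b)
    expand = ℕ-Ring.solve-∀

  term≈shift : ∀ a b → term a b ≈ shift (expo a b) (invS (den a b))
  term≈shift a b = *S-qpow (expo a b) (invS (den a b))

  Δ-term : ∀ j d a b a′ b′ → expo a′ b′ ≡ d + expo a b →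
           den a′ b′ ≈ den a b *S (oneS -S (qS ^S j)) →
           Δ j (term a′ b′) ≈ shift d (term a b)
  Δ-term j d a b a′ b′ expo≡ den≈ =
    ≈-trans (Δ-cong j (term≈shift a′ b′))
    (≈-trans (Δ-shift j (expo a′ b′) (invS (den a′ b′)))
    (≈-trans (shift-cong (expo a′ b′)
                         (Δ-invS j (den a b) (den a′ b′) (den-const a b) (den-const a′ b′) den≈))
    (≈-trans (shift-≡ (invS (den a b)) expo≡)
    (≈-trans (shift-+ d (expo a b) (invS (den a b)))
             (shift-cong d (≈-sym (term≈shift a b)))))))

  Δ-term-suc₁ : ∀ a b → Δ (suc a) (term (suc a) b) ≈ shift (4 * a + 1 + 6 * b) (term a b)
  Δ-term-suc₁ a b = Δ-term (suc a) (4 * a + 1 + 6 * b) a b (suc a) b (expo-suc₁ a b) (den-suc₁ a b)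

  Δ-term-suc₂ : ∀ a b → Δ (3 * suc b) (term a (suc b)) ≈ shift (12 * b + 6 * a + 5) (term a b)
  Δ-term-suc₂ a b = Δ-term (3 * suc b) (12 * b + 6 * a + 5) a b a (suc b) (expo-suc₂ a b) (den-suc₂ a b)

  term-0-0 : term 0 0 ≈ oneS
  term-0-0 = ≈-trans (term≈shift 0 0)
    (inverse-unique (den 0 0) (invS (den 0 0)) oneS (*S-invS (den 0 0) (den-const 0 0))
                    (≈-trans (*S-identityʳ (den 0 0)) (*S-identityˡ oneS)))

open Summands

module Diagonal where

  open import Data.Bool using (Bool; true; false; T; if_then_else_)
  open import Data.Empty using (⊥-elim)
  open import Data.Integer as ℤ using (ℤ; +_; -_)
  import Data.Integer.Properties as ℤP
  open import Data.List using (map; upTo)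
  open import Data.Nat using (ℕ; zero; suc; _+_; _*_; _≤_; _<_; _≡ᵇ_)
  import Data.Nat.Properties as ℕP
  import Data.Nat.Tactic.RingSolver as ℕ-Ring
  open import Relation.Binary.PropositionalEquality

  when : Bool → ℤ → ℤ
  when c x = if c then x else + 0

  when-+ : ∀ c x y → when c (x ℤ.+ y) ≡ when c x ℤ.+ when c y
  when-+ true  x y = refl
  when-+ false x y = refl

  when-neg : ∀ c x → when c (- x) ≡ - when c x
  when-neg true  x = refl
  when-neg false x = refl

  when-0 : ∀ c → when c (+ 0) ≡ + 0
  when-0 true  = refl
  when-0 false = refl

  when-≡ᵇ-cong : ∀ x m {u v} → (x ≡ m → u ≡ v) → when (x ≡ᵇ m) u ≡ when (x ≡ᵇ m) v
  when-≡ᵇ-cong x m u≡v with x ≡ᵇ m in eq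
  ... | true  = u≡v (ℕP.≡ᵇ⇒≡ x m (subst T (sym eq) _))
  ... | false = refl

  when-≡ᵇ-no : ∀ x m u → x ≢ m → when (x ≡ᵇ m) u ≡ + 0
  when-≡ᵇ-no x m u x≢m =
    trans (when-≡ᵇ-cong x m (λ x≡m → ⊥-elim (x≢m x≡m))) (when-0 (x ≡ᵇ m))

  Family : Set
  Family = ℕ → ℕ → Series

  onLine : ℕ → Family → ℕ → ℕ → ℕ → ℤ
  onLine m F n a b = when (2 * b + a ≡ᵇ m) (F a b n)

  diagSum : ℕ → ℕ → ℕ → Family → Series
  diagSum A B m F n = Σℤ A (λ a → Σℤ B (onLine m F n a))

  diagSum-cong : ∀ A B m {F G} → (∀ a b → 2 * b + a ≡ m → F a b ≈ G a b) →
                 diagSum A B m F ≈ diagSum A B m G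
  diagSum-cong A B m F≈G n =
    Σℤ-cong A (λ a → Σℤ-cong B (λ b → when-≡ᵇ-cong (2 * b + a) m (λ on → F≈G a b on n)))

  diagSum-zero : ∀ A B m F n → (∀ a b → F a b n ≡ + 0) → diagSum A B m F n ≡ + 0
  diagSum-zero A B m F n F≡0 = Σℤ-zero A _ (λ a → Σℤ-zero B _ (λ b →
    trans (cong (when (2 * b + a ≡ᵇ m)) (F≡0 a b)) (when-0 (2 * b + a ≡ᵇ m))))

  diagSum-+S : ∀ A B m F G → diagSum A B m (λ a b → F a b +S G a b) ≈ diagSum A B m F +S diagSum A B m G
  diagSum-+S A B m F G n =
    trans (Σℤ-cong A (λ a → trans (Σℤ-cong B (λ b → when-+ (2 * b + a ≡ᵇ m) (F a b n) (G a b n)))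
                                  (Σℤ-+ B (onLine m F n a) (onLine m G n a))))
          (Σℤ-+ A (λ a → Σℤ B (onLine m F n a)) (λ a → Σℤ B (onLine m G n a)))

  diagSum-negS : ∀ A B m F → diagSum A B m (λ a b → negS (F a b)) ≈ negS (diagSum A B m F)
  diagSum-negS A B m F n =
    trans (Σℤ-cong A (λ a → trans (Σℤ-cong B (λ b → when-neg (2 * b + a ≡ᵇ m) (F a b n)))
                                  (Σℤ-neg B (onLine m F n a))))
          (Σℤ-neg A (λ a → Σℤ B (onLine m F n a)))

  diagSum-shift : ∀ e A B m F → diagSum A B m (λ a b → shift e (F a b)) ≈ shift e (diagSum A B m F)
  diagSum-shift zero    A B m F = ≈-refl
  diagSum-shift (suc e) A B m F zero    = diagSum-zero A B m (λ a b → shift (suc e) (F a b)) 0 (λ _ _ → refl)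
  diagSum-shift (suc e) A B m F (suc n) = diagSum-shift e A B m F n

  diagSum-suc₁ : ∀ A B m F → (∀ b → F 0 b ≈ 0S) →
                 diagSum (suc A) B (suc m) F ≈ diagSum A B m (λ a b → F (suc a) b)
  diagSum-suc₁ A B m F F0≈0 n =
    trans (cong (ℤ._+ Σℤ A (λ a → Σℤ B (onLine (suc m) F n (suc a))))
                (Σℤ-zero B _ (λ b → trans (cong (when (2 * b + 0 ≡ᵇ suc m)) (F0≈0 b n)) (when-0 _))))
    (trans (ℤP.+-identityˡ _)
           (Σℤ-cong A (λ a → Σℤ-cong B (λ b →
              cong (λ x → when (x ≡ᵇ suc m) (F (suc a) b n)) (ℕP.+-suc (2 * b) a)))))

  2*[1+b]+a≡2+[2*b+a] : ∀ b a → 2 * suc b + a ≡ suc (suc (2 * b + a))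
  2*[1+b]+a≡2+[2*b+a] = ℕ-Ring.solve-∀

  diagSum-suc₂ : ∀ A B m F → (∀ a → F a 0 ≈ 0S) →
                 diagSum A (suc B) (suc (suc m)) F ≈ diagSum A B m (λ a b → F a (suc b))
  diagSum-suc₂ A B m F Fa0≈0 n = Σℤ-cong A (λ a →
    trans (cong (ℤ._+ Σℤ B (λ b → onLine (suc (suc m)) F n a (suc b)))
                (trans (cong (when (a ≡ᵇ suc (suc m))) (Fa0≈0 a n)) (when-0 _)))
    (trans (ℤP.+-identityˡ _)
           (Σℤ-cong B (λ b → cong (λ x → when (x ≡ᵇ suc (suc m)) (F a (suc b) n))
                                  (2*[1+b]+a≡2+[2*b+a] b a)))))

  diagSum-shrink₁ : ∀ A B m F → m < A → diagSum (suc A) B m F ≈ diagSum A B m F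
  diagSum-shrink₁ A B m F m<A n =
    trans (Σℤ-last A (λ a → Σℤ B (onLine m F n a)))
    (trans (cong (ℤ._+_ (diagSum A B m F n))
                 (Σℤ-zero B _ (λ b → when-≡ᵇ-no (2 * b + A) m (F A b n)
                    (λ on → ℕP.<⇒≱ m<A (subst (A ≤_) on (ℕP.m≤n+m A (2 * b)))))))
           (ℤP.+-identityʳ _))

  diagSum-shrink₂ : ∀ A B m F → m < B → diagSum A (suc B) m F ≈ diagSum A B m F
  diagSum-shrink₂ A B m F m<B n = Σℤ-cong A (λ a →
    trans (Σℤ-last B (onLine m F n a))
    (trans (cong (ℤ._+_ (Σℤ B (onLine m F n a)))
                 (when-≡ᵇ-no (2 * B + a) m (F a B n) (λ on → ℕP.<⇒≱ m<B (subst (B ≤_) on (B≤2*B+a a)))))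
           (ℤP.+-identityʳ _)))
    where
    B≤2*B+a : ∀ a → B ≤ 2 * B + a
    B≤2*B+a a = ℕP.≤-trans (ℕP.m≤m+n B (B + 0)) (ℕP.m≤m+n (2 * B) a)

  diag : ℕ → Family → Series
  diag m = diagSum (suc m) (suc m) m

  rhsCoeff≡diag : ∀ n m → rhsCoeff n m ≡ diag m term n
  rhsCoeff≡diag n m =
    trans (sumℤ-map-upTo (suc m) (λ a → sumℤ (map (λ b → when (2 * b + a ≡ᵇ m) (term a b n)) (upTo (suc m)))))
          (Σℤ-cong (suc m) (λ a → sumℤ-map-upTo (suc m) (λ b → when (2 * b + a ≡ᵇ m) (term a b n))))

  diag-cong : ∀ m {F G} → (∀ a b → 2 * b + a ≡ m → F a b ≈ G a b) → diag m F ≈ diag m G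
  diag-cong m = diagSum-cong (suc m) (suc m) m

  diag-cong′ : ∀ m {F G} → (∀ a b → F a b ≈ G a b) → diag m F ≈ diag m G
  diag-cong′ m F≈G = diag-cong m (λ a b _ → F≈G a b)

  diag-vanishes : ∀ m F → (∀ a b → 2 * b + a ≡ m → F a b ≈ 0S) → diag m F ≈ 0S
  diag-vanishes m F F≈0 =
    ≈-trans (diag-cong m F≈0) (λ n → diagSum-zero (suc m) (suc m) m (λ _ _ → 0S) n (λ _ _ → refl))

  diag-+S : ∀ m F G → diag m (λ a b → F a b +S G a b) ≈ diag m F +S diag m G
  diag-+S m = diagSum-+S (suc m) (suc m) m

  diag--S : ∀ m F G → diag m (λ a b → F a b -S G a b) ≈ diag m F -S diag m G
  diag--S m F G = ≈-trans (diag-+S m F (λ a b → negS (G a b)))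
                          (+S-cong (≈-refl {diag m F}) (diagSum-negS (suc m) (suc m) m G))

  diag-shift : ∀ e m F → diag m (λ a b → shift e (F a b)) ≈ shift e (diag m F)
  diag-shift e m = diagSum-shift e (suc m) (suc m) m

  diag-zero : ∀ F → diag 0 F ≈ F 0 0
  diag-zero F n = trans (ℤP.+-identityʳ _) (ℤP.+-identityʳ _)

  diag-suc₁ : ∀ m F → (∀ b → F 0 b ≈ 0S) → diag (suc m) F ≈ diag m (λ a b → F (suc a) b)
  diag-suc₁ m F F0≈0 = ≈-trans (diagSum-suc₁ (suc m) (suc (suc m)) m F F0≈0)
                               (diagSum-shrink₂ (suc m) (suc m) m (λ a b → F (suc a) b) (ℕP.n<1+n m))

  diag-suc₂ : ∀ m F → (∀ a → F a 0 ≈ 0S) → diag (suc (suc m)) F ≈ diag m (λ a b → F a (suc b))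
  diag-suc₂ m F Fa0≈0 =
    ≈-trans (diagSum-suc₂ (suc (suc (suc m))) (suc (suc m)) m F Fa0≈0)
    (≈-trans (diagSum-shrink₁ (suc (suc m)) (suc (suc m)) m F′ (ℕP.m<n⇒m<1+n (ℕP.n<1+n m)))
    (≈-trans (diagSum-shrink₁ (suc m) (suc (suc m)) m F′ (ℕP.n<1+n m))
             (diagSum-shrink₂ (suc m) (suc m) m F′ (ℕP.n<1+n m))))
    where
    F′ : Family
    F′ a b = F a (suc b)

open Diagonal

module RightHandSide where

  open import Data.Nat using (ℕ; zero; suc; _+_; _*_; _≤_; _<_; z≤n; s≤s)
  import Data.Nat.Properties as ℕP
  import Data.Nat.Tactic.RingSolver as ℕ-Ring
  open import Data.Empty using (⊥-elim)
  open import Relation.Binary.PropositionalEquality using (_≡_; refl; sym; trans; cong; subst)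
  open import Relation.Binary.Reasoning.Setoid ≈-setoid

  Exponent : Set
  Exponent = ℕ → ℕ → ℕ

  summand : Exponent → Family
  summand c a b = shift (c a b) (term a b)

  summandΔ : Exponent → Exponent → Family
  summandΔ d c a b = shift (c a b) (Δ (d a b) (term a b))

  Φ : ℕ → Exponent → Series
  Φ m c = diag m (summand c)

  ΦΔ : Exponent → ℕ → Exponent → Series
  ΦΔ d m c = diag m (summandΔ d c)

  Φ-cong : ∀ m {c c′} → (∀ a b → c a b ≡ c′ a b) → Φ m c ≈ Φ m c′
  Φ-cong m c≡c′ = diag-cong′ m (λ a b → shift-≡ (term a b) (c≡c′ a b))

  shift-Φ : ∀ (e : ℕ → ℕ) m c {c′} → (∀ a b → e (2 * b + a) + c a b ≡ c′ a b) →
            shift (e m) (Φ m c) ≈ Φ m c′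
  shift-Φ e m c {c′} e+c≡c′ = begin
    shift (e m) (Φ m c)
      ≈⟨ diag-shift (e m) m (summand c) ⟨
    diag m (λ a b → shift (e m) (summand c a b))
      ≈⟨ diag-cong′ m (λ a b → shift-+ (e m) (c a b) (term a b)) ⟨
    diag m (summand (λ a b → e m + c a b))
      ≈⟨ diag-cong m (λ a b on → shift-≡ (term a b) (trans (cong (λ m → e m + c a b) (sym on))
                                                           (e+c≡c′ a b))) ⟩
    Φ m c′ ∎

  Φ-sub : ∀ m c d → Φ m c -S Φ m (λ a b → c a b + d a b) ≈ ΦΔ d m c
  Φ-sub m c d = ≈-trans (≈-sym (diag--S m (summand c) (summand (λ a b → c a b + d a b))))
                        (diag-cong′ m (λ a b → shift-Δ (c a b) (d a b) (term a b)))

  ΦΔ-+ : ∀ d d′ m c → ΦΔ (λ a b → d a b + d′ a b) m c ≈ ΦΔ d m c +S ΦΔ d′ m (λ a b → c a b + d a b)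
  ΦΔ-+ d d′ m c =
    ≈-trans (diag-cong′ m split) (diag-+S m (summandΔ d c) (summandΔ d′ (λ a b → c a b + d a b)))
    where
    split : ∀ a b → summandΔ (λ a b → d a b + d′ a b) c a b
                  ≈ summandΔ d c a b +S summandΔ d′ (λ a b → c a b + d a b) a b
    split a b = ≈-trans (shift-cong (c a b) (Δ-+ (d a b) (d′ a b) (term a b)))
      (≈-trans (shift-+S (c a b) (Δ (d a b) (term a b)) (shift (d a b) (Δ (d′ a b) (term a b))))
               (+S-cong (≈-refl {summandΔ d c a b})
                        (≈-sym (shift-+ (c a b) (d a b) (Δ (d′ a b) (term a b))))))

  α β : Exponent
  α a b = a
  β a b = 3 * b

  shift-Δ-zero : ∀ c f → shift c (Δ 0 f) ≈ 0S
  shift-Δ-zero c f = ≈-trans (shift-cong c (Δ-zero f)) (shift-0S c)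

  ΦΔα-zero : ∀ c → ΦΔ α 0 c ≈ 0S
  ΦΔα-zero c = diag-vanishes 0 (summandΔ α c) (λ a b on → vanish a b (ℕP.m+n≡0⇒n≡0 (2 * b) on))
    where
    vanish : ∀ a b → a ≡ 0 → summandΔ α c a b ≈ 0S
    vanish a b refl = shift-Δ-zero (c 0 b) (term 0 b)

  ΦΔα-suc : ∀ m c → ΦΔ α (suc m) c ≈ Φ m (λ a b → c (suc a) b + (4 * a + 1 + 6 * b))
  ΦΔα-suc m c = ≈-trans (diag-suc₁ m (summandΔ α c) (λ b → shift-Δ-zero (c 0 b) (term 0 b)))
    (diag-cong′ m (λ a b → ≈-trans (shift-cong (c (suc a) b) (Δ-term-suc₁ a b))
                                   (≈-sym (shift-+ (c (suc a) b) (4 * a + 1 + 6 * b) (term a b)))))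

  ΦΔβ-below-2 : ∀ m c → m < 2 → ΦΔ β m c ≈ 0S
  ΦΔβ-below-2 m c m<2 = diag-vanishes m (summandΔ β c) vanish
    where
    vanish : ∀ a b → 2 * b + a ≡ m → summandΔ β c a b ≈ 0S
    vanish a zero    on = shift-Δ-zero (c a 0) (term a 0)
    vanish a (suc b) on =
      ⊥-elim (ℕP.<⇒≱ m<2 (subst (2 ≤_) (trans (sym (2*[1+b]+a≡2+[2*b+a] b a)) on) (s≤s (s≤s z≤n))))

  ΦΔβ-suc : ∀ m c → ΦΔ β (suc (suc m)) c ≈ Φ m (λ a b → c a (suc b) + (12 * b + 6 * a + 5))
  ΦΔβ-suc m c = ≈-trans (diag-suc₂ m (summandΔ β c) (λ a → shift-Δ-zero (c a 0) (term a 0)))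
    (diag-cong′ m (λ a b → ≈-trans (shift-cong (c a (suc b)) (Δ-term-suc₂ a b))
                                   (≈-sym (shift-+ (c a (suc b)) (12 * b + 6 * a + 5) (term a b)))))

  ΦΔα≈ΦΔβ : ∀ m c c′ →
            (∀ a b → c (suc a) b + (4 * a + 1 + 6 * b) ≡ c′ a (suc b) + (12 * b + 6 * a + 5)) →
            ΦΔ α m c ≈ ΦΔ β (suc m) c′
  ΦΔα≈ΦΔβ zero    c c′ exponents = ≈-trans (ΦΔα-zero c) (≈-sym (ΦΔβ-below-2 1 c′ (ℕP.n<1+n 1)))
  ΦΔα≈ΦΔβ (suc m) c c′ exponents =
    ≈-trans (ΦΔα-suc m c) (≈-trans (Φ-cong m exponents) (≈-sym (ΦΔβ-suc m c′)))

  R₁ R₂ R₃ : ℕ → Series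
  R₁ m = Φ m (λ _ _ → 0)
  R₂ m = Φ m (λ a b → a + 3 * b)
  R₃ m = Φ m (λ a b → 2 * a + 3 * b)

  Φ-zero : ∀ c → c 0 0 ≡ 0 → Φ 0 c ≈ oneS
  Φ-zero c c₀₀≡0 = ≈-trans (diag-zero (summand c)) (≈-trans (shift-≡ (term 0 0) c₀₀≡0) term-0-0)

  R₁-suc : ∀ m → R₁ (suc m) ≈ R₂ (suc m) +S shift (3 * m + 1) (R₁ m)
  R₁-suc m = from-difference-telescoped {R₁ (suc m)} {R₂ (suc m)} split telescope
    where
    split : R₁ (suc m) -S R₂ (suc m) ≈ Φ m (λ a b → 4 * a + 1 + 6 * b) +S ΦΔ β (suc m) α
    split = begin
      R₁ (suc m) -S R₂ (suc m)
        ≈⟨ Φ-sub (suc m) (λ _ _ → 0) (λ a b → a + 3 * b) ⟩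
      ΦΔ (λ a b → a + 3 * b) (suc m) (λ _ _ → 0)
        ≈⟨ ΦΔ-+ α β (suc m) (λ _ _ → 0) ⟩
      ΦΔ α (suc m) (λ _ _ → 0) +S ΦΔ β (suc m) α
        ≈⟨ +S-cong (ΦΔα-suc m (λ _ _ → 0)) (≈-refl {ΦΔ β (suc m) α}) ⟩
      Φ m (λ a b → 4 * a + 1 + 6 * b) +S ΦΔ β (suc m) α ∎
    telescope : shift (3 * m + 1) (R₁ m) -S Φ m (λ a b → 4 * a + 1 + 6 * b) ≈ ΦΔ β (suc m) α
    telescope = begin
      shift (3 * m + 1) (R₁ m) -S Φ m (λ a b → 4 * a + 1 + 6 * b)
        ≈⟨ -S-cong (shift-Φ (λ m → 3 * m + 1) m (λ _ _ → 0) e₁) (Φ-cong m e₂) ⟩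
      Φ m (λ a b → 3 * a + 6 * b + 1) -S Φ m (λ a b → 3 * a + 6 * b + 1 + a)
        ≈⟨ Φ-sub m (λ a b → 3 * a + 6 * b + 1) α ⟩
      ΦΔ α m (λ a b → 3 * a + 6 * b + 1)
        ≈⟨ ΦΔα≈ΦΔβ m (λ a b → 3 * a + 6 * b + 1) α e₃ ⟩
      ΦΔ β (suc m) α ∎
      where
      e₁ : ∀ a b → 3 * (2 * b + a) + 1 + 0 ≡ 3 * a + 6 * b + 1
      e₁ = ℕ-Ring.solve-∀
      e₂ : ∀ a b → 4 * a + 1 + 6 * b ≡ 3 * a + 6 * b + 1 + a
      e₂ = ℕ-Ring.solve-∀
      e₃ : ∀ a b → 3 * suc a + 6 * b + 1 + (4 * a + 1 + 6 * b) ≡ a + (12 * b + 6 * a + 5)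
      e₃ = ℕ-Ring.solve-∀

  R₂-suc : ∀ m → R₂ (suc m) ≈ R₃ (suc m) +S shift (3 * m + 2) (R₃ m)
  R₂-suc m = from-difference {R₂ (suc m)} {R₃ (suc m)} (begin
    R₂ (suc m) -S R₃ (suc m)
      ≈⟨ -S-cong (≈-refl {R₂ (suc m)}) (Φ-cong (suc m) e₁) ⟩
    R₂ (suc m) -S Φ (suc m) (λ a b → a + 3 * b + a)
      ≈⟨ Φ-sub (suc m) (λ a b → a + 3 * b) α ⟩
    ΦΔ α (suc m) (λ a b → a + 3 * b)
      ≈⟨ ΦΔα-suc m (λ a b → a + 3 * b) ⟩
    Φ m (λ a b → suc a + 3 * b + (4 * a + 1 + 6 * b))
      ≈⟨ shift-Φ (λ m → 3 * m + 2) m (λ a b → 2 * a + 3 * b) e₂ ⟨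
    shift (3 * m + 2) (R₃ m) ∎)
    where
    e₁ : ∀ a b → 2 * a + 3 * b ≡ a + 3 * b + a
    e₁ = ℕ-Ring.solve-∀
    e₂ : ∀ a b → 3 * (2 * b + a) + 2 + (2 * a + 3 * b) ≡ suc a + 3 * b + (4 * a + 1 + 6 * b)
    e₂ = ℕ-Ring.solve-∀

  private
    c₃ c₄ c₅ : Exponent
    c₃ a b = 2 * suc a + 3 * b + (4 * a + 1 + 6 * b)
    c₄ a b = 2 * a + 3 * b + a
    c₅ a b = 8 * a + 15 * b + 8

  R₃-split : ∀ m → R₃ (suc m) -S shift (3 * suc m) (R₁ (suc m)) ≈ Φ m c₃ +S ΦΔ β (suc m) c₄
  R₃-split m = begin
    R₃ (suc m) -S shift (3 * suc m) (R₁ (suc m))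
      ≈⟨ -S-cong (≈-refl {R₃ (suc m)}) (shift-Φ (3 *_) (suc m) (λ _ _ → 0) e) ⟩
    R₃ (suc m) -S Φ (suc m) (λ a b → 2 * a + 3 * b + (a + 3 * b))
      ≈⟨ Φ-sub (suc m) (λ a b → 2 * a + 3 * b) (λ a b → a + 3 * b) ⟩
    ΦΔ (λ a b → a + 3 * b) (suc m) (λ a b → 2 * a + 3 * b)
      ≈⟨ ΦΔ-+ α β (suc m) (λ a b → 2 * a + 3 * b) ⟩
    ΦΔ α (suc m) (λ a b → 2 * a + 3 * b) +S ΦΔ β (suc m) c₄
      ≈⟨ +S-cong (ΦΔα-suc m (λ a b → 2 * a + 3 * b)) (≈-refl {ΦΔ β (suc m) c₄}) ⟩
    Φ m c₃ +S ΦΔ β (suc m) c₄ ∎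
    where
    e : ∀ a b → 3 * (2 * b + a) + 0 ≡ 2 * a + 3 * b + (a + 3 * b)
    e = ℕ-Ring.solve-∀

  R₃-residue₁ : ∀ m → Φ m c₃ -S shift (6 * m + 3) (R₁ m) ≈ ΦΔ β m c₃
  R₃-residue₁ m =
    ≈-trans (-S-cong (≈-refl {Φ m c₃}) (shift-Φ (λ m → 6 * m + 3) m (λ _ _ → 0) e)) (Φ-sub m c₃ β)
    where
    e : ∀ a b → 6 * (2 * b + a) + 3 + 0 ≡ 2 * suc a + 3 * b + (4 * a + 1 + 6 * b) + 3 * b
    e = ℕ-Ring.solve-∀

  R₃-residue₂ : ∀ m → shift (6 * m + 8) (R₃ m) -S ΦΔ β (suc (suc m)) c₄ ≈ ΦΔ β (suc m) c₃
  R₃-residue₂ m = begin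
    shift (6 * m + 8) (R₃ m) -S ΦΔ β (suc (suc m)) c₄
      ≈⟨ -S-cong (shift-Φ (λ m → 6 * m + 8) m (λ a b → 2 * a + 3 * b) e₁) (ΦΔβ-suc m c₄) ⟩
    Φ m c₅ -S Φ m (λ a b → c₄ a (suc b) + (12 * b + 6 * a + 5))
      ≈⟨ -S-cong (≈-refl {Φ m c₅}) (Φ-cong m e₂) ⟩
    Φ m c₅ -S Φ m (λ a b → c₅ a b + a)
      ≈⟨ Φ-sub m c₅ α ⟩
    ΦΔ α m c₅
      ≈⟨ ΦΔα≈ΦΔβ m c₅ c₃ e₃ ⟩
    ΦΔ β (suc m) c₃ ∎
    where
    e₁ : ∀ a b → 6 * (2 * b + a) + 8 + (2 * a + 3 * b) ≡ 8 * a + 15 * b + 8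
    e₁ = ℕ-Ring.solve-∀
    e₂ : ∀ a b → 2 * a + 3 * suc b + a + (12 * b + 6 * a + 5) ≡ 8 * a + 15 * b + 8 + a
    e₂ = ℕ-Ring.solve-∀
    e₃ : ∀ a b → 8 * suc a + 15 * b + 8 + (4 * a + 1 + 6 * b)
               ≡ 2 * suc a + 3 * suc b + (4 * a + 1 + 6 * suc b) + (12 * b + 6 * a + 5)
    e₃ = ℕ-Ring.solve-∀

  R₃-one : R₃ 1 ≈ shift 3 (R₁ 1) +S shift 3 (R₁ 0)
  R₃-one = from-difference-vanishing {u = Φ 0 c₃} {v = ΦΔ β 1 c₄} {t₁ = shift 3 (R₁ 0)}
    (R₃-split 0)
    (≈-trans (R₃-residue₁ 0) (ΦΔβ-below-2 0 c₃ (s≤s z≤n)))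
    (ΦΔβ-below-2 1 c₄ (ℕP.n<1+n 1))

  R₃-suc-suc : ∀ m → R₃ (suc (suc m)) ≈ shift (3 * suc (suc m)) (R₁ (suc (suc m)))
                                        +S (shift (6 * suc m + 3) (R₁ (suc m)) +S shift (6 * m + 8) (R₃ m))
  R₃-suc-suc m = from-difference-split {u = Φ (suc m) c₃} {v = ΦΔ β (suc (suc m)) c₄}
    {t₁ = shift (6 * suc m + 3) (R₁ (suc m))} {t₂ = shift (6 * m + 8) (R₃ m)}
    (R₃-split (suc m)) (R₃-residue₁ (suc m)) (R₃-residue₂ m)

  rhs-recurrences : Recurrences R₁ R₂ R₃
  rhs-recurrences = record
    { init₁     = Φ-zero (λ _ _ → 0) refl
    ; init₃     = Φ-zero (λ a b → 2 * a + 3 * b) refl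
    ; step₁     = R₁-suc
    ; step₂     = R₂-suc
    ; step₃-one = R₃-one
    ; step₃     = R₃-suc-suc
    }

open RightHandSide

module Chains where

  open import Data.Bool using (Bool; true; false; T; if_then_else_; _∧_; _∨_)
  open import Data.Bool.Properties using (∧-assoc; ∧-zeroʳ; T-≡)
  open import Data.Empty using (⊥-elim)
  open import Data.List using (List; []; _∷_; map; applyUpTo; _++_; concatMap; filter; length)
  open import Data.List.Properties using (map-upTo)
  open import Data.Nat using (ℕ; zero; suc; _+_; _*_; _∸_; _≤_; _<_; _≤ᵇ_; _≡ᵇ_; _%_; z≤n; s≤s)
  import Data.Nat.Properties as ℕP
  open import Data.Nat.DivMod using ([m+n]%n≡m%n)
  import Data.Nat.Tactic.RingSolver as ℕ-Ring
  open import Relation.Nullary using (yes; no)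
  open import Algebra.Properties.CommutativeSemigroup ℕP.+-commutativeSemigroup
    using () renaming (interchange to +-interchange)
  open import Function using (_∘_)
  open import Function.Bundles using (Equivalence)
  open import Relation.Nullary.Decidable using (T?)
  open import Relation.Binary.PropositionalEquality

  Σℕ : ℕ → (ℕ → ℕ) → ℕ
  Σℕ zero    f = 0
  Σℕ (suc n) f = f 0 + Σℕ n (f ∘ suc)

  Σℕ-cong : ∀ n {f g : ℕ → ℕ} → (∀ i → f i ≡ g i) → Σℕ n f ≡ Σℕ n g
  Σℕ-cong zero    e = refl
  Σℕ-cong (suc n) e = cong₂ _+_ (e 0) (Σℕ-cong n (e ∘ suc))

  Σℕ-zero : ∀ n f → (∀ i → i < n → f i ≡ 0) → Σℕ n f ≡ 0
  Σℕ-zero zero    f f≡0 = refl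
  Σℕ-zero (suc n) f f≡0 =
    cong₂ _+_ (f≡0 0 (s≤s z≤n)) (Σℕ-zero n (f ∘ suc) (λ i i<n → f≡0 (suc i) (s≤s i<n)))

  Σℕ-+ : ∀ n f g → Σℕ n (λ i → f i + g i) ≡ Σℕ n f + Σℕ n g
  Σℕ-+ zero    f g = refl
  Σℕ-+ (suc n) f g = trans (cong (_+_ (f 0 + g 0)) (Σℕ-+ n (f ∘ suc) (g ∘ suc)))
                           (+-interchange (f 0) (g 0) _ _)

  Σℕ-truncate : ∀ r N f g → r ≤ N → (∀ i → i < r → f i ≡ g i) → (∀ i → r ≤ i → i < N → f i ≡ 0) →
                Σℕ N f ≡ Σℕ r g
  Σℕ-truncate zero    N       f g r≤N f≡g f≡0 = Σℕ-zero N f (λ i i<N → f≡0 i z≤n i<N)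
  Σℕ-truncate (suc r) (suc N) f g (s≤s r≤N) f≡g f≡0 =
    cong₂ _+_ (f≡g 0 (s≤s z≤n))
              (Σℕ-truncate r N (f ∘ suc) (g ∘ suc) r≤N (λ i i<r → f≡g (suc i) (s≤s i<r))
                           (λ i r≤i i<N → f≡0 (suc i) (s≤s r≤i) (s≤s i<N)))

  whenℕ : Bool → ℕ → ℕ
  whenℕ c x = if c then x else 0

  whenℕ-0 : ∀ c → whenℕ c 0 ≡ 0
  whenℕ-0 true  = refl
  whenℕ-0 false = refl

  countᵇ : (List ℕ → Bool) → List (List ℕ) → ℕ
  countᵇ p []       = 0
  countᵇ p (l ∷ ls) = whenℕ (p l) 1 + countᵇ p ls

  length-filter≡countᵇ : ∀ p ls → length (filter (λ l → T? (p l)) ls) ≡ countᵇ p ls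
  length-filter≡countᵇ p []       = refl
  length-filter≡countᵇ p (l ∷ ls) with p l
  ... | true  = cong suc (length-filter≡countᵇ p ls)
  ... | false = length-filter≡countᵇ p ls

  countᵇ-++ : ∀ p ls ks → countᵇ p (ls ++ ks) ≡ countᵇ p ls + countᵇ p ks
  countᵇ-++ p []       ks = refl
  countᵇ-++ p (l ∷ ls) ks =
    trans (cong (_+_ (whenℕ (p l) 1)) (countᵇ-++ p ls ks)) (sym (ℕP.+-assoc (whenℕ (p l) 1) _ _))

  countᵇ-map-∷ : ∀ p x ls → countᵇ p (map (x ∷_) ls) ≡ countᵇ (λ l → p (x ∷ l)) ls
  countᵇ-map-∷ p x []       = refl
  countᵇ-map-∷ p x (l ∷ ls) = cong (_+_ (whenℕ (p (x ∷ l)) 1)) (countᵇ-map-∷ p x ls)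

  countᵇ-cong : ∀ {p q} ls → (∀ l → p l ≡ q l) → countᵇ p ls ≡ countᵇ q ls
  countᵇ-cong []       p≡q = refl
  countᵇ-cong (l ∷ ls) p≡q = cong₂ (λ b n → whenℕ b 1 + n) (p≡q l) (countᵇ-cong ls p≡q)

  countᵇ-∧ : ∀ c p ls → countᵇ (λ l → c ∧ p l) ls ≡ whenℕ c (countᵇ p ls)
  countᵇ-∧ true  p ls = refl
  countᵇ-∧ false p ls = none ls
    where
    none : ∀ ls → countᵇ (λ _ → false) ls ≡ 0
    none []       = refl
    none (l ∷ ls) = none ls

  countᵇ-concatMap : ∀ p n (g : ℕ → ℕ) (f : ℕ → List (List ℕ)) →
                     countᵇ p (concatMap f (applyUpTo g n)) ≡ Σℕ n (λ i → countᵇ p (f (g i)))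
  countᵇ-concatMap p zero    g f = refl
  countᵇ-concatMap p (suc n) g f =
    trans (countᵇ-++ p (f (g 0)) _) (cong (_+_ (countᵇ p (f (g 0)))) (countᵇ-concatMap p n (g ∘ suc) f))

  countLists : ℕ → (List ℕ → Bool) → ℕ → ℕ
  countLists N p m = countᵇ p (listsOf m (oneTo N))

  countLists-suc : ∀ N p m → countLists N p (suc m) ≡ Σℕ N (λ i → countLists N (λ l → p (suc i ∷ l)) m)
  countLists-suc N p m =
    trans (cong (λ xs → countᵇ p (concatMap (λ x → map (x ∷_) (listsOf m (oneTo N))) xs)) (map-upTo suc N))
    (trans (countᵇ-concatMap p N suc (λ x → map (x ∷_) (listsOf m (oneTo N))))
           (Σℕ-cong N (λ i → countᵇ-map-∷ p (suc i) (listsOf m (oneTo N)))))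

  ≤ᵇ-true : ∀ {b r} → b ≤ r → (b ≤ᵇ r) ≡ true
  ≤ᵇ-true b≤r = Equivalence.to T-≡ (ℕP.≤⇒≤ᵇ b≤r)

  ≤ᵇ-false : ∀ {b r} → r < b → (b ≤ᵇ r) ≡ false
  ≤ᵇ-false {b} {r} r<b with b ≤ᵇ r in eq
  ... | true  = ⊥-elim (ℕP.<⇒≱ r<b (ℕP.≤ᵇ⇒≤ b r (subst T (sym eq) _)))
  ... | false = refl

  whenℕ-≤ᵇ-yes : ∀ {b r} x → b ≤ r → whenℕ (b ≤ᵇ r) x ≡ x
  whenℕ-≤ᵇ-yes x b≤r = cong (λ c → whenℕ c x) (≤ᵇ-true b≤r)

  whenℕ-≤ᵇ-no : ∀ {b r} x → r < b → whenℕ (b ≤ᵇ r) x ≡ 0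
  whenℕ-≤ᵇ-no x r<b = cong (λ c → whenℕ c x) (≤ᵇ-false r<b)

  -- the number of lists λ₁ … λₘ of positive integers with sum r such that a λ₁ … λₘ satisfies chainOK
  continuations : ℕ → ℕ → ℕ → ℕ
  continuations a r zero    = whenℕ (r ≡ᵇ 0) 1
  continuations a r (suc m) = Σℕ r (λ i → whenℕ (pairOK a (suc i)) (continuations (suc i) (r ∸ suc i) m))

  -- the number of lists λ₁ … λₘ₊₁ of positive integers with sum r satisfying chainOK and P λ₁
  withFirstPart : (ℕ → Bool) → ℕ → ℕ → ℕ
  withFirstPart P r m = Σℕ r (λ i → whenℕ (P (suc i)) (continuations (suc i) (r ∸ suc i) m))

  -- the number of lists λ₁ … λₘ of positive integers with sum r satisfying chainOK and lo ≤ λ₁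
  chainsFrom : ℕ → ℕ → ℕ → ℕ
  chainsFrom lo r zero    = whenℕ (r ≡ᵇ 0) 1
  chainsFrom lo r (suc m) = withFirstPart (lo ≤ᵇ_) r m

  isContinuation : ℕ → ℕ → List ℕ → Bool
  isContinuation a r l = (sumℕ l ≡ᵇ r) ∧ chainOK (a ∷ l)

  ≡ᵇ-+-split : ∀ b s r → (b + s ≡ᵇ r) ≡ (b ≤ᵇ r) ∧ (s ≡ᵇ r ∸ b)
  ≡ᵇ-+-split zero    s r       = refl
  ≡ᵇ-+-split (suc b) s zero    = refl
  ≡ᵇ-+-split (suc b) s (suc r) = trans (≡ᵇ-+-split b s r) (cong (_∧ (s ≡ᵇ r ∸ b)) (sym (≤ᵇ-suc b r)))

  ∧-rearrange : ∀ p b s c → (b ∧ s) ∧ (p ∧ c) ≡ (p ∧ b) ∧ (s ∧ c)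
  ∧-rearrange true  b     s c = ∧-assoc b s c
  ∧-rearrange false true  s c = ∧-zeroʳ s
  ∧-rearrange false false s c = refl

  whenℕ-∧-≤ᵇ : ∀ P i r x → whenℕ (P ∧ (suc i ≤ᵇ r)) x ≡ whenℕ (suc i ≤ᵇ r) (whenℕ P x)
  whenℕ-∧-≤ᵇ true  i r x = refl
  whenℕ-∧-≤ᵇ false i r x = sym (whenℕ-0 (suc i ≤ᵇ r))

  mutual
    countLists≡continuations : ∀ m N a r → r ≤ N → countLists N (isContinuation a r) m ≡ continuations a r m
    countLists≡continuations zero    N a zero    r≤N = refl
    countLists≡continuations zero    N a (suc r) r≤N = refl
    countLists≡continuations (suc m) N a r       r≤N =
      countLists≡withFirstPart m N (pairOK a) r (isContinuation a r) r≤N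
      (λ i l → trans (cong (_∧ chainOK (a ∷ suc i ∷ l)) (≡ᵇ-+-split (suc i) (sumℕ l) r))
                     (∧-rearrange (pairOK a (suc i)) (suc i ≤ᵇ r) (sumℕ l ≡ᵇ r ∸ suc i) (chainOK (suc i ∷ l))))

    countLists≡withFirstPart : ∀ m N P r p → r ≤ N →
      (∀ i l → p (suc i ∷ l) ≡ (P (suc i) ∧ (suc i ≤ᵇ r)) ∧ isContinuation (suc i) (r ∸ suc i) l) →
      countLists N p (suc m) ≡ withFirstPart P r m
    countLists≡withFirstPart m N P r p r≤N p≡ = trans (countLists-suc N p m)
      (trans (Σℕ-cong N first-part)
             (Σℕ-truncate r N _ entry r≤N (λ i i<r → whenℕ-≤ᵇ-yes (entry i) i<r)
                                          (λ i r≤i _ → whenℕ-≤ᵇ-no (entry i) (s≤s r≤i))))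
      where
      entry : ℕ → ℕ
      entry i = whenℕ (P (suc i)) (continuations (suc i) (r ∸ suc i) m)
      first-part : ∀ i → countLists N (λ l → p (suc i ∷ l)) m ≡ whenℕ (suc i ≤ᵇ r) (entry i)
      first-part i =
        trans (countᵇ-cong (listsOf m (oneTo N)) (p≡ i))
        (trans (countᵇ-∧ (P (suc i) ∧ (suc i ≤ᵇ r)) (isContinuation (suc i) (r ∸ suc i)) (listsOf m (oneTo N)))
        (trans (cong (whenℕ (P (suc i) ∧ (suc i ≤ᵇ r)))
                     (countLists≡continuations m N (suc i) (r ∸ suc i) (ℕP.≤-trans (ℕP.m∸n≤m r (suc i)) r≤N)))
               (whenℕ-∧-≤ᵇ (P (suc i)) i r _)))

  cp≡chainsFrom : ∀ n m → cp n m ≡ chainsFrom 1 n m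
  cp≡chainsFrom n zero    = trans (length-filter≡countᵇ (isCP n) (listsOf 0 (oneTo n))) (empty n)
    where
    empty : ∀ n → countᵇ (isCP n) ([] ∷ []) ≡ chainsFrom 1 n 0
    empty zero    = refl
    empty (suc n) = refl
  cp≡chainsFrom n (suc m) = trans (length-filter≡countᵇ (isCP n) (listsOf (suc m) (oneTo n)))
    (countLists≡withFirstPart m n (1 ≤ᵇ_) n (isCP n) ℕP.≤-refl
      (λ i l → trans (cong (_∧ chainOK (suc i ∷ l)) (≡ᵇ-+-split (suc i) (sumℕ l) n))
                     (∧-assoc (suc i ≤ᵇ n) (sumℕ l ≡ᵇ n ∸ suc i) (chainOK (suc i ∷ l)))))

  Σℕ-single : ∀ n l (X : ℕ → ℕ) → Σℕ n (λ i → whenℕ (l ≡ᵇ i) (X i)) ≡ whenℕ (suc l ≤ᵇ n) (X l)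
  Σℕ-single zero    l       X = refl
  Σℕ-single (suc n) zero    X = trans (cong (_+_ (X 0)) (Σℕ-zero n _ (λ i _ → refl))) (ℕP.+-identityʳ (X 0))
  Σℕ-single (suc n) (suc l) X =
    trans (Σℕ-single n l (X ∘ suc)) (cong (λ b → whenℕ b (X (suc l))) (sym (≤ᵇ-suc (suc l) n)))

  whenℕ-≤ᵇ-split : ∀ l i x → whenℕ (l ≤ᵇ i) x ≡ whenℕ (suc l ≤ᵇ i) x + whenℕ (l ≡ᵇ i) x
  whenℕ-≤ᵇ-split zero    zero    x = refl
  whenℕ-≤ᵇ-split zero    (suc i) x = sym (ℕP.+-identityʳ x)
  whenℕ-≤ᵇ-split (suc l) zero    x = refl
  whenℕ-≤ᵇ-split (suc l) (suc i) x = trans (cong (λ b → whenℕ b x) (≤ᵇ-suc l i))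
    (trans (whenℕ-≤ᵇ-split l i x) (cong (λ b → whenℕ b x + whenℕ (l ≡ᵇ i) x) (sym (≤ᵇ-suc (suc l) i))))

  withFirstPart-≥-split : ∀ l r m → withFirstPart (suc l ≤ᵇ_) r m
    ≡ withFirstPart (suc (suc l) ≤ᵇ_) r m + whenℕ (suc l ≤ᵇ r) (continuations (suc l) (r ∸ suc l) m)
  withFirstPart-≥-split l r m =
    trans (Σℕ-cong r (λ i → trans (cong (λ b → whenℕ b (X i)) (≤ᵇ-suc l i))
                           (trans (whenℕ-≤ᵇ-split l i (X i))
                                  (cong (λ b → whenℕ b (X i) + whenℕ (l ≡ᵇ i) (X i)) (sym (≤ᵇ-suc (suc l) i))))))
    (trans (Σℕ-+ r (λ i → whenℕ (suc (suc l) ≤ᵇ suc i) (X i)) (λ i → whenℕ (l ≡ᵇ i) (X i)))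
           (cong (_+_ (withFirstPart (suc (suc l) ≤ᵇ_) r m)) (Σℕ-single r l X)))
    where
    X : ℕ → ℕ
    X i = continuations (suc i) (r ∸ suc i) m

  pairOK-1 : ∀ i → pairOK 1 (suc i) ≡ (4 ≤ᵇ suc i)
  pairOK-1 0 = refl
  pairOK-1 1 = refl
  pairOK-1 2 = refl
  pairOK-1 3 = refl
  pairOK-1 (suc (suc (suc (suc i)))) = refl

  pairOK-2 : ∀ i → pairOK 2 (suc i) ≡ (6 ≤ᵇ suc i)
  pairOK-2 0 = refl
  pairOK-2 1 = refl
  pairOK-2 2 = refl
  pairOK-2 3 = refl
  pairOK-2 4 = refl
  pairOK-2 5 = refl
  pairOK-2 (suc (suc (suc (suc (suc (suc i)))))) = refl

  pairOK-5 : ∀ i → pairOK 5 (suc i) ≡ (9 ≤ᵇ suc i)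
  pairOK-5 0 = refl
  pairOK-5 1 = refl
  pairOK-5 2 = refl
  pairOK-5 3 = refl
  pairOK-5 4 = refl
  pairOK-5 5 = refl
  pairOK-5 6 = refl
  pairOK-5 7 = refl
  pairOK-5 8 = refl
  pairOK-5 (suc (suc (suc (suc (suc (suc (suc (suc (suc i))))))))) = refl

  whenℕ-pairOK-3 : ∀ i x → whenℕ (pairOK 3 (suc i)) x ≡ whenℕ (7 ≤ᵇ suc i) x + whenℕ (4 ≡ᵇ i) x
  whenℕ-pairOK-3 0 x = refl
  whenℕ-pairOK-3 1 x = refl
  whenℕ-pairOK-3 2 x = refl
  whenℕ-pairOK-3 3 x = refl
  whenℕ-pairOK-3 4 x = refl
  whenℕ-pairOK-3 5 x = refl
  whenℕ-pairOK-3 6 x = sym (ℕP.+-identityʳ x)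
  whenℕ-pairOK-3 (suc (suc (suc (suc (suc (suc (suc i))))))) x = sym (ℕP.+-identityʳ x)

  continuations≡chainsFrom : ∀ a lo → (∀ i → pairOK a (suc i) ≡ (lo ≤ᵇ suc i)) →
                             ∀ r m → continuations a r m ≡ chainsFrom lo r m
  continuations≡chainsFrom a lo pairOK≡ r zero    = refl
  continuations≡chainsFrom a lo pairOK≡ r (suc m) = Σℕ-cong r (λ i → cong (λ b → whenℕ b _) (pairOK≡ i))

  continuations-3 : ∀ r m →
    continuations 3 r (suc m) ≡ chainsFrom 7 r (suc m) + whenℕ (5 ≤ᵇ r) (continuations 5 (r ∸ 5) m)
  continuations-3 r m = trans (Σℕ-cong r (λ i → whenℕ-pairOK-3 i (X i)))
    (trans (Σℕ-+ r (λ i → whenℕ (7 ≤ᵇ suc i) (X i)) (λ i → whenℕ (4 ≡ᵇ i) (X i)))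
           (cong (_+_ (chainsFrom 7 r (suc m))) (Σℕ-single r 4 X)))
    where
    X : ℕ → ℕ
    X i = continuations (suc i) (r ∸ suc i) m

  ≤ᵇ-+3 : ∀ a c → (3 + a ≤ᵇ 3 + c) ≡ (a ≤ᵇ c)
  ≤ᵇ-+3 a c = trans (≤ᵇ-suc (2 + a) (2 + c)) (trans (≤ᵇ-suc (1 + a) (1 + c)) (≤ᵇ-suc a c))

  pairOK-+3 : ∀ a c → pairOK (3 + a) (3 + c) ≡ pairOK a c
  pairOK-+3 a c = cong₂ (λ b s → b ∧ ((2 ≤ᵇ (c ∸ a)) ∧ ((4 ≤ᵇ (c ∸ a)) ∨ (s ≡ᵇ 2)))) (≤ᵇ-+3 a c) mod3
    where
    regroup : ∀ a c → 3 + a + (3 + c) ≡ a + c + 3 + 3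
    regroup = ℕ-Ring.solve-∀
    mod3 : (3 + a + (3 + c)) % 3 ≡ (a + c) % 3
    mod3 = trans (cong (_% 3) (regroup a c)) (trans ([m+n]%n≡m%n (a + c + 3) 3) ([m+n]%n≡m%n (a + c) 3))

  pairOK-+3-small : ∀ a c → c ≤ 3 → pairOK (3 + a) c ≡ false
  pairOK-+3-small a c c≤3 rewrite ℕP.m≤n⇒m∸n≡0 (ℕP.≤-trans c≤3 (ℕP.m≤m+n 3 a)) =
    ∧-zeroʳ (3 + a ≤ᵇ c)

  ∸-∸-comm : ∀ r a b → r ∸ a ∸ b ≡ r ∸ b ∸ a
  ∸-∸-comm r a b =
    trans (ℕP.∸-+-assoc r a b) (trans (cong (r ∸_) (ℕP.+-comm a b)) (sym (ℕP.∸-+-assoc r b a)))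

  Σℕ-delay : ∀ t r (Y : ℕ → ℕ → ℕ) →
    Σℕ r (λ i → whenℕ (t ≤ᵇ r ∸ suc i) (Y i (r ∸ suc i ∸ t)))
    ≡ whenℕ (t ≤ᵇ r) (Σℕ (r ∸ t) (λ i → Y i (r ∸ t ∸ suc i)))
  Σℕ-delay t r Y with t ℕP.≤? r
  ... | yes t≤r = trans (Σℕ-truncate (r ∸ t) r delayed (λ i → Y i (r ∸ t ∸ suc i)) (ℕP.m∸n≤m r t) agree vanish)
                        (sym (whenℕ-≤ᵇ-yes (Σℕ (r ∸ t) (λ i → Y i (r ∸ t ∸ suc i))) t≤r))
    where
    delayed : ℕ → ℕ
    delayed i = whenℕ (t ≤ᵇ r ∸ suc i) (Y i (r ∸ suc i ∸ t))
    t≤r∸[1+i] : ∀ i → i < r ∸ t → t ≤ r ∸ suc i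
    t≤r∸[1+i] i i<r∸t =
      ℕP.m+n≤o⇒m≤o∸n t (subst (_≤ r) (ℕP.+-comm (suc i) t) (ℕP.m≤o∸n⇒m+n≤o (suc i) t≤r i<r∸t))
    r∸[1+i]<t : ∀ i → r ∸ t ≤ i → i < r → r ∸ suc i < t
    r∸[1+i]<t i r∸t≤i i<r = subst (r ∸ suc i <_) (ℕP.m+n∸n≡m t (suc i))
      (ℕP.∸-monoˡ-< (ℕP.≤-<-trans (ℕP.≤-trans (ℕP.m≤n+m∸n r t) (ℕP.+-monoʳ-≤ t r∸t≤i))
                                  (ℕP.+-monoʳ-< t (ℕP.n<1+n i))) i<r)
    agree : ∀ i → i < r ∸ t → delayed i ≡ Y i (r ∸ t ∸ suc i)
    agree i i<r∸t = trans (whenℕ-≤ᵇ-yes (Y i (r ∸ suc i ∸ t)) (t≤r∸[1+i] i i<r∸t)) (cong (Y i) (∸-∸-comm r (suc i) t))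
    vanish : ∀ i → r ∸ t ≤ i → i < r → delayed i ≡ 0
    vanish i r∸t≤i i<r = whenℕ-≤ᵇ-no (Y i (r ∸ suc i ∸ t)) (r∸[1+i]<t i r∸t≤i i<r)
  ... | no t≰r = trans (Σℕ-zero r _ (λ i _ → whenℕ-≤ᵇ-no (Y i (r ∸ suc i ∸ t)) (ℕP.≤-<-trans (ℕP.m∸n≤m r (suc i)) r<t)))
                       (sym (whenℕ-≤ᵇ-no (Σℕ (r ∸ t) (λ i → Y i (r ∸ t ∸ suc i))) r<t))
    where
    r<t : r < t
    r<t = ℕP.≰⇒> t≰r

  whenℕ-comm : ∀ b c x → whenℕ b (whenℕ c x) ≡ whenℕ c (whenℕ b x)
  whenℕ-comm true  c x = refl
  whenℕ-comm false c x = sym (whenℕ-0 c)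

  -- raising every part by 3 raises the sum of m + 1 parts by 3m + 3
  withFirstPart-+3 : ∀ m P P′ → (∀ c → P′ (3 + c) ≡ P c) → (∀ c → c ≤ 3 → P′ c ≡ false) →
    (∀ a r → continuations (3 + a) r m ≡ whenℕ (3 * m ≤ᵇ r) (continuations a (r ∸ 3 * m) m)) →
    ∀ r → withFirstPart P′ r m ≡ whenℕ (3 + 3 * m ≤ᵇ r) (withFirstPart P (r ∸ (3 + 3 * m)) m)
  withFirstPart-+3 m P P′ P′-+3 P′-small continuations-+3 zero = refl
  withFirstPart-+3 m P P′ P′-+3 P′-small continuations-+3 (suc zero) =
    cong (λ b → whenℕ b _ + 0) (P′-small 1 (s≤s z≤n))
  withFirstPart-+3 m P P′ P′-+3 P′-small continuations-+3 (suc (suc zero)) =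
    cong₂ (λ b b′ → whenℕ b _ + (whenℕ b′ _ + 0)) (P′-small 1 (s≤s z≤n)) (P′-small 2 (s≤s (s≤s z≤n)))
  withFirstPart-+3 m P P′ P′-+3 P′-small continuations-+3 (suc (suc (suc r))) =
    trans (cong₂ (λ b b′ → whenℕ b _ + (whenℕ b′ _ + (whenℕ (P′ 3) _ + Σℕ r shifted)))
                 (P′-small 1 (s≤s z≤n)) (P′-small 2 (s≤s (s≤s z≤n))))
    (trans (cong (λ b → whenℕ b _ + Σℕ r shifted) (P′-small 3 ℕP.≤-refl))
    (trans (Σℕ-cong r raised)
    (trans (Σℕ-delay (3 * m) r (λ i s → whenℕ (P (suc i)) (continuations (suc i) s m)))
           (cong (λ b → whenℕ b (withFirstPart P (r ∸ 3 * m) m)) (sym (≤ᵇ-+3 (3 * m) r))))))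
    where
    shifted : ℕ → ℕ
    shifted i = whenℕ (P′ (suc (3 + i))) (continuations (suc (3 + i)) (r ∸ suc i) m)
    raised : ∀ i → shifted i
                 ≡ whenℕ (3 * m ≤ᵇ r ∸ suc i) (whenℕ (P (suc i)) (continuations (suc i) (r ∸ suc i ∸ 3 * m) m))
    raised i = trans (cong₂ whenℕ (P′-+3 (suc i)) (continuations-+3 (suc i) (r ∸ suc i)))
                     (whenℕ-comm (P (suc i)) (3 * m ≤ᵇ r ∸ suc i) (continuations (suc i) (r ∸ suc i ∸ 3 * m) m))

  continuations-+3 : ∀ m a r → continuations (3 + a) r m ≡ whenℕ (3 * m ≤ᵇ r) (continuations a (r ∸ 3 * m) m)
  continuations-+3 zero    a r = refl
  continuations-+3 (suc m) a r =
    trans (withFirstPart-+3 m (pairOK a) (pairOK (3 + a)) (pairOK-+3 a) (pairOK-+3-small a) (continuations-+3 m) r)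
          (cong (λ t → whenℕ (t ≤ᵇ r) (continuations a (r ∸ t) (suc m))) (sym (ℕP.*-suc 3 m)))

  chainsFrom-+3 : ∀ m l r → chainsFrom (3 + suc l) r m ≡ whenℕ (3 * m ≤ᵇ r) (chainsFrom (suc l) (r ∸ 3 * m) m)
  chainsFrom-+3 zero    l r = refl
  chainsFrom-+3 (suc m) l r =
    trans (withFirstPart-+3 m (suc l ≤ᵇ_) (3 + suc l ≤ᵇ_) (≤ᵇ-+3 (suc l))
            (λ c c≤3 → ≤ᵇ-false (s≤s (ℕP.≤-trans c≤3 (ℕP.m≤m+n 3 l)))) (continuations-+3 m) r)
          (cong (λ t → whenℕ (t ≤ᵇ r) (chainsFrom (suc l) (r ∸ t) (suc m))) (sym (ℕP.*-suc 3 m)))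

open Chains

module LeftHandSide where

  open import Data.Bool using (true; false; if_then_else_)
  open import Data.Integer as ℤ using (+_)
  import Data.Integer.Properties as ℤP
  open import Data.Nat using (ℕ; zero; suc; _+_; _*_; _∸_; _≤ᵇ_)
  import Data.Nat.Properties as ℕP
  import Data.Nat.Tactic.RingSolver as ℕ-Ring
  open import Relation.Binary.PropositionalEquality using (_≡_; refl; sym; trans; cong)
  open import Relation.Binary.Reasoning.Setoid ≈-setoid

  chainGF : ℕ → ℕ → Series
  chainGF lo m n = + chainsFrom lo n m

  continuationGF : ℕ → ℕ → Series
  continuationGF a m n = + continuations a n m

  +whenℕ≡shift : ∀ e (f : ℕ → ℕ) n → + whenℕ (e ≤ᵇ n) (f (n ∸ e)) ≡ shift e (λ k → + f k) n
  +whenℕ≡shift e f n = trans (lemma (e ≤ᵇ n)) (sym (shift-if e (λ k → + f k) n))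
    where
    lemma : ∀ b → + whenℕ b (f (n ∸ e)) ≡ (if b then + f (n ∸ e) else + 0)
    lemma true  = refl
    lemma false = refl

  chainGF-zero : ∀ lo → chainGF lo 0 ≈ oneS
  chainGF-zero lo zero    = refl
  chainGF-zero lo (suc n) = refl

  chainGF-smallest : ∀ l m → chainGF (suc l) (suc m)
                            ≈ chainGF (suc (suc l)) (suc m) +S shift (suc l) (continuationGF (suc l) m)
  chainGF-smallest l m n = trans (cong +_ (withFirstPart-≥-split l n m))
    (trans (ℤP.pos-+ (chainsFrom (suc (suc l)) n (suc m)) _)
           (cong (ℤ._+_ (chainGF (suc (suc l)) (suc m) n))
                 (+whenℕ≡shift (suc l) (λ k → continuations (suc l) k m) n)))

  chainGF-+3 : ∀ l m → chainGF (3 + suc l) m ≈ shift (3 * m) (chainGF (suc l) m)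
  chainGF-+3 l m n =
    trans (cong +_ (chainsFrom-+3 m l n)) (+whenℕ≡shift (3 * m) (λ k → chainsFrom (suc l) k m) n)

  chainGF-+6 : ∀ l m → chainGF (6 + suc l) m ≈ shift (6 * m) (chainGF (suc l) m)
  chainGF-+6 l m = ≈-trans (chainGF-+3 (3 + l) m)
    (≈-trans (shift-cong (3 * m) (chainGF-+3 l m)) (shift-merge (3 * m) (3 * m) (chainGF (suc l) m) (double m)))
    where
    double : ∀ m → 3 * m + 3 * m ≡ 6 * m
    double = ℕ-Ring.solve-∀

  continuationGF≡chainGF : ∀ a lo → (∀ i → pairOK a (suc i) ≡ (lo ≤ᵇ suc i)) →
                           ∀ m → continuationGF a m ≈ chainGF lo m
  continuationGF≡chainGF a lo pairOK≡ m n = cong +_ (continuations≡chainsFrom a lo pairOK≡ n m)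

  continuationGF-3 : ∀ m → continuationGF 3 (suc m) ≈ chainGF 7 (suc m) +S shift 5 (continuationGF 5 m)
  continuationGF-3 m n = trans (cong +_ (continuations-3 n m))
    (trans (ℤP.pos-+ (chainsFrom 7 n (suc m)) _)
           (cong (ℤ._+_ (chainGF 7 (suc m) n)) (+whenℕ≡shift 5 (λ k → continuations 5 k m) n)))

  chainGF-step : ∀ l lo m → (∀ i → pairOK (suc l) (suc i) ≡ (3 + suc lo ≤ᵇ suc i)) →
    chainGF (suc l) (suc m) ≈ chainGF (suc (suc l)) (suc m) +S shift (3 * m + suc l) (chainGF (suc lo) m)
  chainGF-step l lo m pairOK≡ =
    ≈-trans (chainGF-smallest l m) (+S-cong (≈-refl {chainGF (suc (suc l)) (suc m)}) rest)
    where
    rest : shift (suc l) (continuationGF (suc l) m) ≈ shift (3 * m + suc l) (chainGF (suc lo) m)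
    rest = ≈-trans (shift-cong (suc l) (≈-trans (continuationGF≡chainGF (suc l) (3 + suc lo) pairOK≡ m)
                                                      (chainGF-+3 lo m)))
                          (shift-merge (suc l) (3 * m) (chainGF (suc lo) m) (ℕP.+-comm (suc l) (3 * m)))

  chainGF-3-suc-suc : ∀ m → chainGF 3 (suc (suc m)) ≈ shift (3 * suc (suc m)) (chainGF 1 (suc (suc m)))
                            +S (shift (6 * suc m + 3) (chainGF 1 (suc m)) +S shift (6 * m + 8) (chainGF 3 m))
  chainGF-3-suc-suc m = ≈-trans (chainGF-smallest 2 (suc m))
    (+S-cong (chainGF-+3 0 (suc (suc m))) rest)
    where
    next-≥7 : shift 3 (chainGF 7 (suc m)) ≈ shift (6 * suc m + 3) (chainGF 1 (suc m))
    next-≥7 = ≈-trans (shift-cong 3 (chainGF-+6 0 (suc m)))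
                      (shift-merge 3 (6 * suc m) (chainGF 1 (suc m)) (ℕP.+-comm 3 (6 * suc m)))
    next-5 : shift 3 (shift 5 (continuationGF 5 m)) ≈ shift (6 * m + 8) (chainGF 3 m)
    next-5 = ≈-trans (shift-cong 3 (shift-cong 5 (≈-trans (continuationGF≡chainGF 5 9 pairOK-5 m) (chainGF-+6 2 m))))
      (≈-trans (shift-cong 3 (shift-merge 5 (6 * m) (chainGF 3 m) refl))
               (shift-merge 3 (5 + 6 * m) (chainGF 3 m) (e m)))
      where
      e : ∀ m → 3 + (5 + 6 * m) ≡ 6 * m + 8
      e = ℕ-Ring.solve-∀
    rest : shift 3 (continuationGF 3 (suc m))
                ≈ shift (6 * suc m + 3) (chainGF 1 (suc m)) +S shift (6 * m + 8) (chainGF 3 m)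
    rest = ≈-trans (shift-cong 3 (continuationGF-3 m)) (≈-trans (shift-+S 3 _ _) (+S-cong next-≥7 next-5))

  lhs-recurrences : Recurrences (chainGF 1) (chainGF 2) (chainGF 3)
  lhs-recurrences = record
    { init₁     = chainGF-zero 1
    ; init₃     = chainGF-zero 3
    ; step₁     = λ m → chainGF-step 0 0 m pairOK-1
    ; step₂     = λ m → chainGF-step 1 2 m pairOK-2
    ; step₃-one = ≈-trans (chainGF-smallest 2 0) (+S-cong (chainGF-+3 0 1) (≈-refl {shift 3 (chainGF 1 0)}))
    ; step₃     = chainGF-3-suc-suc
    }

open LeftHandSide

theorem12 : (n m : ℕ) → + (cp n m) ≡ rhsCoeff n m
theorem12 n m = begin
  + cp n m          ≡⟨ cong +_ (cp≡chainsFrom n m) ⟩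
  chainGF 1 m n     ≡⟨ recurrences-unique lhs-recurrences rhs-recurrences m n ⟩
  diag m term n     ≡⟨ rhsCoeff≡diag n m ⟨
  rhsCoeff n m      ∎
  where open Relation.Binary.PropositionalEquality.≡-Reasoning
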